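{- Let $m\ge 2$ and let $\mu_1,\ldots,\mu_m$ be positive integers with $n=\sum_{i=1}^m\mu_i$. Define $$\Upsilon=\frac{n^2-n}{\sum_{i=1}^m\mu_i^2-n},$$ with the convention $\Upsilon=\infty$ when $\mu_1=\cdots=\mu_m=1$. Then for every integer $k\ge m$: if $k<\Upsilon$, the uniform distribution $U_k=(1/k,\ldots,1/k)$ is a local maximum of the function $\beta_k:\Pi_{[k]}\to[0,1]$, and if $k>\Upsilon$, $U_k$ is a local minimum of $\beta_k$.
   Context: For a positive integer $k$, $[k]=\{1,\ldots,k\}$ and $\Pi_{[k]}=\{\mathbf p=(p_1,\ldots,p_k): p_i\ge 0,\ \sum_i p_i=1\}$ is the probability simplex. The quantity $(\mu_1,\ldots,\mu_m)$ is the list of multiplicities of a pattern (the sequence obtained from a length-$n$ sequence by replacing each symbol by the order of its first occurrence; symbol $i$ appears $\mu_i$ times). For $\mathbf p\in\Pi_{[k]}$ with $k\ge m$, the pattern probability is $$\beta_k(\mathbf p)=P(\psi;\mathbf p)=\sum_{\sigma}\prod_{i=1}^m p_{\sigma(i)}^{\mu_i},$$ where the sum is over all one-to-one maps $\sigma:[m]\to[k]$. Local maximum/minimum are meant relative to $\Pi_{[k]}$, i.e. compared with all points of $\Pi_{[k]}$ in a neighbourhood of $U_k$.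
   Formalization: The points of $\Pi_{[k]}$ compared with $U_k$ have rational coordinates, and the neighbourhoods of $U_k$ have rational radius. -}

module Defs where

open import Data.Nat as ℕ using (ℕ; zero; suc)
open import Data.Integer as ℤ using (ℤ)
open import Data.Rational as ℚ using (ℚ; 0ℚ; 1ℚ; _+_; _*_; _-_; _≤_; _<_; ∣_∣)
open import Data.Fin using (Fin)
open import Data.Fin.Properties using (_≟_)
open import Data.Vec as Vec using (Vec; []; _∷_)
open import Data.List as List using (List; []; _∷_; concatMap; filter; allFin)
open import Data.List.Relation.Unary.Unique.Propositional using (Unique)
open import Data.List.Relation.Unary.AllPairs using (allPairs?)
open import Relation.Nullary.Decidable using (¬?)
open import Data.Product using (Σ; ∃; _×_)
open import Relation.Binary.PropositionalEquality using (_≡_)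
open import Data.Unit using (⊤)
open import Data.Empty using (⊥)

_^ℚ_ : ℚ → ℕ → ℚ
x ^ℚ zero = 1ℚ
x ^ℚ suc e = x * (x ^ℚ e)

sumℕ : ∀ {m} → (Fin m → ℕ) → ℕ
sumℕ {m} f = List.foldr ℕ._+_ 0 (List.map f (allFin m))

sumℚ : ∀ {k} → (Fin k → ℚ) → ℚ
sumℚ {k} f = List.foldr _+_ 0ℚ (List.map f (allFin k))

prodℚ : ∀ {m} → (Fin m → ℚ) → ℚ
prodℚ {m} f = List.foldr _*_ 1ℚ (List.map f (allFin m))

-- every map Fin m → Fin k, listed once each, as a vector of its values
allVecs : (m k : ℕ) → List (Vec (Fin k) m)
allVecs zero k = [] ∷ []
allVecs (suc m) k = concatMap (λ x → List.map (x ∷_) (allVecs m k)) (allFin k)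

injections : (m k : ℕ) → List (Vec (Fin k) m)
injections m k = filter (λ v → allPairs? (λ x y → ¬? (x ≟ y)) (Vec.toList v)) (allVecs m k)

β : ∀ {m} (k : ℕ) → (μ : Fin m → ℕ) → (Fin k → ℚ) → ℚ
β {m} k μ p =
  List.foldr _+_ 0ℚ
    (List.map (λ σ → prodℚ (λ i → p (Vec.lookup σ i) ^ℚ μ i)) (injections m k))

InSimplex : ∀ {k} → (Fin k → ℚ) → Set
InSimplex p = (∀ i → 0ℚ ≤ p i) × sumℚ p ≡ 1ℚ


U : (k : ℕ) → Fin k → ℚ
U zero    ()
U (suc k) _ = ℤ.+ 1 ℚ./ suc k

Near : ∀ {k} → ℚ → (Fin k → ℚ) → (Fin k → ℚ) → Set
Near ε q p = ∀ i → ∣ p i - q i ∣ < ε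

IsLocalMax : ∀ {k} → ((Fin k → ℚ) → ℚ) → (Fin k → ℚ) → Set
IsLocalMax f q = ∃ λ ε → (0ℚ < ε) × (∀ p → InSimplex p → Near ε q p → f p ≤ f q)

IsLocalMin : ∀ {k} → ((Fin k → ℚ) → ℚ) → (Fin k → ℚ) → Set
IsLocalMin f q = ∃ λ ε → (0ℚ < ε) × (∀ p → InSimplex p → Near ε q p → f q ≤ f p)

-- extended rationals: Υ may be ∞
data ℚ∞ : Set where
  fin : ℚ → ℚ∞
  ∞   : ℚ∞

_<∞_ : ℚ → ℚ∞ → Set
x <∞ fin y = x < y
x <∞ ∞     = ⊤

_>∞_ : ℚ → ℚ∞ → Set
x >∞ fin y = y < x
x >∞ ∞     = ⊥

-- Υ = (n² - n) / (Σ μ_i² - n), and Υ = ∞ when Σ μ_i² - n = 0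
-- (for positive μ_i this happens exactly when μ_1 = ... = μ_m = 1)
Υ : ∀ {m} → (Fin m → ℕ) → ℚ∞
Υ μ with sumℕ (λ i → μ i ℕ.* μ i) ℕ.∸ sumℕ μ
... | zero  = ∞
... | suc d = fin (ℤ.+ (n ℕ.* n ℕ.∸ n) ℚ./ suc d)
  where n = sumℕ μ

{-# OPTIONS --safe #-}
module Submission where

-- Write p = U_k + x with Σⱼ xⱼ = 0, c = 1/k and n = Σᵢ μᵢ. Every monomial
-- Πᵢ p_{σ(i)}^{μᵢ} of β_k(p) is a product of n factors c + x_j; expanded in the
-- deviations it is cⁿ plus a linear term, a quadratic term and a remainder of
-- size O(D³), where D = maxⱼ |xⱼ|. Summed over the injections σ, the linear term
-- vanishes, and because the set of injections is invariant under relabelling [k],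
-- the quadratic term sums to
--   cⁿ · #injections · (Σⱼ xⱼ²) · Γ / (2c(k − 1)),   Γ = k(Σᵢ μᵢ² − n) − (n² − n).
-- Since Σⱼ xⱼ² ≥ D², the quadratic term dominates the remainder near U_k, so there
-- β_k(p) − β_k(U_k) has the sign of Γ. Finally Γ is an integer, negative exactly
-- when k < Υ and positive exactly when k > Υ.

open import Defs
open import Data.Nat as ℕ using (ℕ; zero; suc)
import Data.Nat.Properties as ℕ
open import Data.Integer as ℤ using (+_)
import Data.Integer.Properties as ℤ
open import Data.Rational using (ℚ; 0ℚ; 1ℚ; _+_; _*_; _-_; -_; _/_; _≤_; _<_; ∣_∣; _⊔_; toℚᵘ; positive; nonNegative)
open import Data.Rational.Properties
import Data.Rational.Unnormalised as ℚᵘ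
import Data.Rational.Unnormalised.Properties as ℚᵘ
import Data.Rational.Solver
open import Data.Fin using (Fin; zero; suc)
open import Data.Fin.Properties using () renaming (_≟_ to _≟ᶠ_)
open import Data.Fin.Permutation as Perm using (Permutation′; _⟨$⟩ʳ_; _⟨$⟩ˡ_)
import Data.Fin.Permutation.Components as PC
import Algebra.Properties.CommutativeMonoid.Sum as CMSum
open import Data.Vec as Vec using (Vec; []; _∷_)
import Data.Vec.Properties as Vec
open import Data.List as List using (List; []; _∷_; _++_; concatMap; filter; allFin)
import Data.List.Properties as List
open import Data.List.Relation.Unary.All as All using (All)
import Data.List.Relation.Unary.All.Properties as All
open import Data.List.Relation.Unary.AllPairs as AllPairs using (AllPairs; allPairs?)
import Data.List.Relation.Unary.AllPairs.Properties as AllPairs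
open import Data.List.Membership.Propositional using (_∈_)
open import Data.List.Membership.Propositional.Properties using (∈-allFin)
open import Data.List.Relation.Unary.Any using (here; there)
open import Data.Bool using (true; false; if_then_else_)
open import Data.Product using (Σ; _×_; _,_)
open import Data.Sum using (_⊎_; inj₁; inj₂)
open import Data.Empty using (⊥-elim)
open import Function using (_∘_)
open import Relation.Nullary using (Dec; yes; no; does; ¬_)
open import Relation.Nullary.Decidable using (¬?; dec-true; dec-false)
open import Relation.Unary using (Pred; Decidable)
open import Relation.Binary.PropositionalEquality

open Data.Rational.Solver.+-*-Solver using (solve; _:+_; _:*_; _:-_; :-_; _:=_; con)

fromℕ : ℕ → ℚ
fromℕ n = + n / 1

fromℕ-suc : ∀ n → fromℕ (suc n) ≡ 1ℚ + fromℕ n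
fromℕ-suc n = toℚᵘ-injective (begin-equality
  toℚᵘ (fromℕ (suc n))               ≃⟨ toℚᵘ-fromℚᵘ _ ⟩
  ℚᵘ.mkℚᵘ (+ suc n) 0                 ≃⟨ ℚᵘ.*≡* cross ⟩
  toℚᵘ 1ℚ ℚᵘ.+ ℚᵘ.mkℚᵘ (+ n) 0       ≃⟨ ℚᵘ.+-congʳ (toℚᵘ 1ℚ) (ℚᵘ.≃-sym (toℚᵘ-fromℚᵘ (ℚᵘ.mkℚᵘ (+ n) 0))) ⟩
  toℚᵘ 1ℚ ℚᵘ.+ toℚᵘ (fromℕ n)        ≃⟨ ℚᵘ.≃-sym (toℚᵘ-homo-+ 1ℚ (fromℕ n)) ⟩
  toℚᵘ (1ℚ + fromℕ n)                ∎)
  where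
  open ℚᵘ.≤-Reasoning
  cross : + suc n ℤ.* + 1 ≡ (+ 1 ℤ.* + 1 ℤ.+ + n ℤ.* + 1) ℤ.* + 1
  cross rewrite ℤ.*-identityʳ (+ n) = refl

fromℕ-+ : ∀ a b → fromℕ (a ℕ.+ b) ≡ fromℕ a + fromℕ b
fromℕ-+ zero    b = sym (+-identityˡ (fromℕ b))
fromℕ-+ (suc a) b = begin
  fromℕ (suc (a ℕ.+ b))       ≡⟨ fromℕ-suc (a ℕ.+ b) ⟩
  1ℚ + fromℕ (a ℕ.+ b)        ≡⟨ cong (λ z → 1ℚ + z) (fromℕ-+ a b) ⟩
  1ℚ + (fromℕ a + fromℕ b)    ≡⟨ +-assoc 1ℚ (fromℕ a) (fromℕ b) ⟨
  (1ℚ + fromℕ a) + fromℕ b    ≡⟨ cong (_+ fromℕ b) (fromℕ-suc a) ⟨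
  fromℕ (suc a) + fromℕ b     ∎
  where open ≡-Reasoning

fromℕ-* : ∀ a b → fromℕ (a ℕ.* b) ≡ fromℕ a * fromℕ b
fromℕ-* zero    b = sym (*-zeroˡ (fromℕ b))
fromℕ-* (suc a) b = begin
  fromℕ (b ℕ.+ a ℕ.* b)              ≡⟨ fromℕ-+ b (a ℕ.* b) ⟩
  fromℕ b + fromℕ (a ℕ.* b)          ≡⟨ cong (λ z → fromℕ b + z) (fromℕ-* a b) ⟩
  fromℕ b + fromℕ a * fromℕ b        ≡⟨ solve 2 (λ x y → y :+ x :* y := (con 1ℚ :+ x) :* y) refl (fromℕ a) (fromℕ b) ⟩
  (1ℚ + fromℕ a) * fromℕ b           ≡⟨ cong (_* fromℕ b) (fromℕ-suc a) ⟨
  fromℕ (suc a) * fromℕ b            ∎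
  where open ≡-Reasoning

0≤fromℕ : ∀ n → 0ℚ ≤ fromℕ n
0≤fromℕ n = nonNegative⁻¹ (fromℕ n) {{normalize-nonNeg n 1}}

fromℕ-mono-≤ : ∀ {a b} → a ℕ.≤ b → fromℕ a ≤ fromℕ b
fromℕ-mono-≤ {a} {b} a≤b = begin
  fromℕ a                       ≡⟨ +-identityʳ (fromℕ a) ⟨
  fromℕ a + 0ℚ                  ≤⟨ +-monoʳ-≤ (fromℕ a) (0≤fromℕ (b ℕ.∸ a)) ⟩
  fromℕ a + fromℕ (b ℕ.∸ a)     ≡⟨ fromℕ-+ a (b ℕ.∸ a) ⟨
  fromℕ (a ℕ.+ (b ℕ.∸ a))       ≡⟨ cong fromℕ (ℕ.m+[n∸m]≡n a≤b) ⟩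
  fromℕ b                       ∎
  where open ≤-Reasoning

1/suc-*-fromℕ : ∀ d → (+ 1 / suc d) * fromℕ (suc d) ≡ 1ℚ
1/suc-*-fromℕ d = toℚᵘ-injective (begin-equality
  toℚᵘ ((+ 1 / suc d) * fromℕ (suc d))                 ≃⟨ toℚᵘ-homo-* (+ 1 / suc d) (fromℕ (suc d)) ⟩
  toℚᵘ (+ 1 / suc d) ℚᵘ.* toℚᵘ (fromℕ (suc d))        ≃⟨ ℚᵘ.*-cong (toℚᵘ-fromℚᵘ (ℚᵘ.mkℚᵘ (+ 1) d)) (toℚᵘ-fromℚᵘ (ℚᵘ.mkℚᵘ (+ suc d) 0)) ⟩
  ℚᵘ.mkℚᵘ (+ 1) d ℚᵘ.* ℚᵘ.mkℚᵘ (+ suc d) 0             ≃⟨ ℚᵘ.*≡* cross ⟩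
  toℚᵘ 1ℚ                                              ∎)
  where
  open ℚᵘ.≤-Reasoning
  cross : (+ 1 ℤ.* + suc d) ℤ.* + 1 ≡ + 1 ℤ.* + suc (d ℕ.* 1)
  cross rewrite ℕ.*-identityʳ d = ℤ.*-identityʳ (+ 1 ℤ.* + suc d)

0<1/suc : ∀ d → 0ℚ < + 1 / suc d
0<1/suc d = positive⁻¹ _ {{normalize-pos 1 (suc d)}}

<-cross-multiply : ∀ a b c d → + a / suc b < + c / suc d → a ℕ.* suc d ℕ.< c ℕ.* suc b
<-cross-multiply a b c d lt
  with ℚᵘ.<-respʳ-≃ (toℚᵘ-fromℚᵘ (ℚᵘ.mkℚᵘ (+ c) d)) (ℚᵘ.<-respˡ-≃ (toℚᵘ-fromℚᵘ (ℚᵘ.mkℚᵘ (+ a) b)) (toℚᵘ-mono-< lt))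
... | ℚᵘ.*<* lt′ = ℤ.drop‿+<+ (subst₂ ℤ._<_ (sym (ℤ.pos-* a (suc d))) (sym (ℤ.pos-* c (suc b))) lt′)

module _ {p q r : ℚ} where

  *-monoˡ-≤-0≤ : 0ℚ ≤ r → p ≤ q → r * p ≤ r * q
  *-monoˡ-≤-0≤ 0≤r = *-monoˡ-≤-nonNeg r {{nonNegative 0≤r}}

  *-monoʳ-≤-0≤ : 0ℚ ≤ r → p ≤ q → p * r ≤ q * r
  *-monoʳ-≤-0≤ 0≤r = *-monoʳ-≤-nonNeg r {{nonNegative 0≤r}}

  *-cancelˡ-≤-0< : 0ℚ < r → r * p ≤ r * q → p ≤ q
  *-cancelˡ-≤-0< 0<r = *-cancelˡ-≤-pos r {{positive 0<r}}

*-mono-≤-0≤ : ∀ {p q r s} → 0ℚ ≤ p → 0ℚ ≤ r → p ≤ q → r ≤ s → p * r ≤ q * s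
*-mono-≤-0≤ 0≤p 0≤r p≤q r≤s = ≤-trans (*-monoʳ-≤-0≤ 0≤r p≤q) (*-monoˡ-≤-0≤ (≤-trans 0≤p p≤q) r≤s)

0≤* : ∀ {p q} → 0ℚ ≤ p → 0ℚ ≤ q → 0ℚ ≤ p * q
0≤* {p} {q} 0≤p 0≤q = nonNegative⁻¹ (p * q) {{nonNeg*nonNeg⇒nonNeg p {{nonNegative 0≤p}} q {{nonNegative 0≤q}}}}

0<* : ∀ {p q} → 0ℚ < p → 0ℚ < q → 0ℚ < p * q
0<* {p} {q} 0<p 0<q = positive⁻¹ (p * q) {{pos*pos⇒pos p {{positive 0<p}} q {{positive 0<q}}}}

neg-involutive : ∀ p → - (- p) ≡ p
neg-involutive = solve 1 (λ x → :- (:- x) := x) refl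

p≤∣p∣ : ∀ p → p ≤ ∣ p ∣
p≤∣p∣ p with ∣p∣≡p∨∣p∣≡-p p
... | inj₁ ∣p∣≡p  = ≤-reflexive (sym ∣p∣≡p)
... | inj₂ ∣p∣≡-p = ≤-trans p≤0 (0≤∣p∣ p)
  where
  p≤0 : p ≤ 0ℚ
  p≤0 = subst (_≤ 0ℚ) (neg-involutive p) (neg-antimono-≤ (subst (0ℚ ≤_) ∣p∣≡-p (0≤∣p∣ p)))

∣p∣≤r⇒p≤r : ∀ {p r} → ∣ p ∣ ≤ r → p ≤ r
∣p∣≤r⇒p≤r {p} = ≤-trans (p≤∣p∣ p)

∣p∣≤r⇒-r≤p : ∀ {p r} → ∣ p ∣ ≤ r → - r ≤ p
∣p∣≤r⇒-r≤p {p} {r} ∣p∣≤r =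
  subst (- r ≤_) (neg-involutive p) (neg-antimono-≤ (∣p∣≤r⇒p≤r (subst (_≤ r) (sym (∣-p∣≡∣p∣ p)) ∣p∣≤r)))

∣p∣*∣p∣≡p*p : ∀ p → ∣ p ∣ * ∣ p ∣ ≡ p * p
∣p∣*∣p∣≡p*p p with ∣p∣≡p∨∣p∣≡-p p
... | inj₁ ∣p∣≡p  = cong₂ _*_ ∣p∣≡p ∣p∣≡p
... | inj₂ ∣p∣≡-p = trans (cong₂ _*_ ∣p∣≡-p ∣p∣≡-p) (solve 1 (λ x → (:- x) :* (:- x) := x :* x) refl p)

0≤p*p : ∀ p → 0ℚ ≤ p * p
0≤p*p p = subst (0ℚ ≤_) (∣p∣*∣p∣≡p*p p) (0≤* (0≤∣p∣ p) (0≤∣p∣ p))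

∣p*q∣≤a*b : ∀ {p q a b} → ∣ p ∣ ≤ a → ∣ q ∣ ≤ b → ∣ p * q ∣ ≤ a * b
∣p*q∣≤a*b {p} {q} ∣p∣≤a ∣q∣≤b =
  subst (_≤ _) (sym (∣p*q∣≡∣p∣*∣q∣ p q)) (*-mono-≤-0≤ (0≤∣p∣ p) (0≤∣p∣ q) ∣p∣≤a ∣q∣≤b)

∣p+q∣≤a+b : ∀ {p q a b} → ∣ p ∣ ≤ a → ∣ q ∣ ≤ b → ∣ p + q ∣ ≤ a + b
∣p+q∣≤a+b {p} {q} ∣p∣≤a ∣q∣≤b = ≤-trans (∣p+q∣≤∣p∣+∣q∣ p q) (+-mono-≤ ∣p∣≤a ∣q∣≤b)

module _ {c : ℚ} where

  ^ℚ-+ : ∀ a b → c ^ℚ (a ℕ.+ b) ≡ c ^ℚ a * c ^ℚ b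
  ^ℚ-+ zero    b = sym (*-identityˡ _)
  ^ℚ-+ (suc a) b = trans (cong (c *_) (^ℚ-+ a b)) (sym (*-assoc c (c ^ℚ a) (c ^ℚ b)))

  0≤^ℚ : 0ℚ ≤ c → ∀ n → 0ℚ ≤ c ^ℚ n
  0≤^ℚ 0≤c zero    = 0≤fromℕ 1
  0≤^ℚ 0≤c (suc n) = 0≤* 0≤c (0≤^ℚ 0≤c n)

  0<^ℚ : 0ℚ < c → ∀ n → 0ℚ < c ^ℚ n
  0<^ℚ 0<c zero    = 0<1/suc 0
  0<^ℚ 0<c (suc n) = 0<* 0<c (0<^ℚ 0<c n)

  ^ℚ≤1 : 0ℚ ≤ c → c ≤ 1ℚ → ∀ n → c ^ℚ n ≤ 1ℚ
  ^ℚ≤1 0≤c c≤1 zero    = ≤-refl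
  ^ℚ≤1 0≤c c≤1 (suc n) = ≤-trans (*-mono-≤-0≤ 0≤c (0≤^ℚ 0≤c n) c≤1 (^ℚ≤1 0≤c c≤1 n)) (≤-reflexive (*-identityˡ 1ℚ))

1/suc≤1 : ∀ d → + 1 / suc d ≤ 1ℚ
1/suc≤1 d = begin
  r                    ≡⟨ *-identityʳ r ⟨
  r * 1ℚ               ≤⟨ *-monoˡ-≤-0≤ (<⇒≤ (0<1/suc d)) (fromℕ-mono-≤ {1} {suc d} (ℕ.s≤s ℕ.z≤n)) ⟩
  r * fromℕ (suc d)    ≡⟨ 1/suc-*-fromℕ d ⟩
  1ℚ                   ∎
  where
  open ≤-Reasoning
  r = + 1 / suc d

∑ : {A : Set} → List A → (A → ℚ) → ℚ
∑ l f = List.foldr _+_ 0ℚ (List.map f l)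

module _ {A : Set} where

  ∑-cong : ∀ (l : List A) {f g : A → ℚ} → (∀ a → f a ≡ g a) → ∑ l f ≡ ∑ l g
  ∑-cong []      f≗g = refl
  ∑-cong (a ∷ l) f≗g = cong₂ _+_ (f≗g a) (∑-cong l f≗g)

  ∑-zero : ∀ (l : List A) → ∑ l (λ _ → 0ℚ) ≡ 0ℚ
  ∑-zero []      = refl
  ∑-zero (a ∷ l) = trans (+-identityˡ _) (∑-zero l)

  ∑-distrib-+ : ∀ (l : List A) (f g : A → ℚ) → ∑ l (λ a → f a + g a) ≡ ∑ l f + ∑ l g
  ∑-distrib-+ []      f g = refl
  ∑-distrib-+ (a ∷ l) f g = trans (cong (λ z → (f a + g a) + z) (∑-distrib-+ l f g))
    (solve 4 (λ x y z w → (x :+ y) :+ (z :+ w) := (x :+ z) :+ (y :+ w)) refl (f a) (g a) (∑ l f) (∑ l g))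

  *-distribˡ-∑ : ∀ (l : List A) (r : ℚ) (f : A → ℚ) → r * ∑ l f ≡ ∑ l (λ a → r * f a)
  *-distribˡ-∑ []      r f = *-zeroʳ r
  *-distribˡ-∑ (a ∷ l) r f = trans (*-distribˡ-+ r (f a) (∑ l f)) (cong (λ z → r * f a + z) (*-distribˡ-∑ l r f))

  *-distribʳ-∑ : ∀ (l : List A) (r : ℚ) (f : A → ℚ) → ∑ l f * r ≡ ∑ l (λ a → f a * r)
  *-distribʳ-∑ l r f = trans (*-comm (∑ l f) r) (trans (*-distribˡ-∑ l r f) (∑-cong l (λ a → *-comm r (f a))))

  neg-distrib-∑ : ∀ (l : List A) (f : A → ℚ) → - ∑ l f ≡ ∑ l (λ a → - f a)
  neg-distrib-∑ []      f = refl
  neg-distrib-∑ (a ∷ l) f = trans (neg-distrib-+ (f a) (∑ l f)) (cong (λ z → - f a + z) (neg-distrib-∑ l f))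

  ∑-distrib-minus : ∀ (l : List A) (f g : A → ℚ) → ∑ l (λ a → f a - g a) ≡ ∑ l f - ∑ l g
  ∑-distrib-minus l f g = trans (∑-distrib-+ l f (λ a → - g a)) (cong (λ z → ∑ l f + z) (sym (neg-distrib-∑ l g)))

  ∑-++ : ∀ (l l′ : List A) (f : A → ℚ) → ∑ (l ++ l′) f ≡ ∑ l f + ∑ l′ f
  ∑-++ []      l′ f = sym (+-identityˡ _)
  ∑-++ (a ∷ l) l′ f = trans (cong (λ z → f a + z) (∑-++ l l′ f)) (sym (+-assoc (f a) (∑ l f) (∑ l′ f)))

  ∑-mono-≤ : ∀ (l : List A) {f g : A → ℚ} → (∀ a → f a ≤ g a) → ∑ l f ≤ ∑ l g
  ∑-mono-≤ []      f≤g = ≤-refl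
  ∑-mono-≤ (a ∷ l) f≤g = +-mono-≤ (f≤g a) (∑-mono-≤ l f≤g)

  0≤∑ : ∀ (l : List A) {f : A → ℚ} → (∀ a → 0ℚ ≤ f a) → 0ℚ ≤ ∑ l f
  0≤∑ l {f} 0≤f = subst (_≤ ∑ l f) (∑-zero l) (∑-mono-≤ l 0≤f)

  ∣∑∣≤∑∣∣ : ∀ (l : List A) (f : A → ℚ) → ∣ ∑ l f ∣ ≤ ∑ l (λ a → ∣ f a ∣)
  ∣∑∣≤∑∣∣ []      f = ≤-refl
  ∣∑∣≤∑∣∣ (a ∷ l) f = ∣p+q∣≤a+b {f a} ≤-refl (∣∑∣≤∑∣∣ l f)

  ∑-filter : ∀ {p} {P : Pred A p} (P? : Decidable P) (l : List A) (f : A → ℚ) →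
    ∑ (filter P? l) f ≡ ∑ l (λ a → if does (P? a) then f a else 0ℚ)
  ∑-filter P? []      f = refl
  ∑-filter P? (a ∷ l) f with does (P? a)
  ... | true  = cong (λ z → f a + z) (∑-filter P? l f)
  ... | false = trans (∑-filter P? l f) (sym (+-identityˡ _))

module _ {A B : Set} where

  ∑-map : ∀ (h : A → B) (l : List A) (f : B → ℚ) → ∑ (List.map h l) f ≡ ∑ l (f ∘ h)
  ∑-map h []      f = refl
  ∑-map h (a ∷ l) f = cong (λ z → f (h a) + z) (∑-map h l f)

  ∑-concatMap : ∀ (g : A → List B) (l : List A) (f : B → ℚ) → ∑ (concatMap g l) f ≡ ∑ l (λ a → ∑ (g a) f)
  ∑-concatMap g []      f = refl
  ∑-concatMap g (a ∷ l) f = trans (∑-++ (g a) (concatMap g l) f) (cong (λ z → ∑ (g a) f + z) (∑-concatMap g l f))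

  ∑-comm : ∀ (l : List A) (l′ : List B) (f : A → B → ℚ) →
    ∑ l (λ a → ∑ l′ (f a)) ≡ ∑ l′ (λ b → ∑ l (λ a → f a b))
  ∑-comm []      l′ f = sym (∑-zero l′)
  ∑-comm (a ∷ l) l′ f = trans (cong (λ z → ∑ l′ (f a) + z) (∑-comm l l′ f))
    (sym (∑-distrib-+ l′ (f a) (λ b → ∑ l (λ a′ → f a′ b))))

  ∑*∑ : ∀ (l : List A) (l′ : List B) (f : A → ℚ) (g : B → ℚ) →
    ∑ l f * ∑ l′ g ≡ ∑ l (λ a → ∑ l′ (λ b → f a * g b))
  ∑*∑ l l′ f g = trans (*-distribʳ-∑ l (∑ l′ g) f) (∑-cong l (λ a → *-distribˡ-∑ l′ (f a) g))

private
  module FinSum = CMSum +-0-commutativeMonoid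

∑-tabulate : ∀ {A : Set} {k} (g : Fin k → A) (f : A → ℚ) → ∑ (List.tabulate g) f ≡ FinSum.sum (f ∘ g)
∑-tabulate {k = zero}  g f = refl
∑-tabulate {k = suc k} g f = cong (λ z → f (g zero) + z) (∑-tabulate (g ∘ suc) f)

sumℚ≡sum : ∀ {k} (f : Fin k → ℚ) → sumℚ f ≡ FinSum.sum f
sumℚ≡sum = ∑-tabulate (λ j → j)

sumℚ-suc : ∀ {k} (f : Fin (suc k) → ℚ) → sumℚ f ≡ f zero + sumℚ (f ∘ suc)
sumℚ-suc f = trans (sumℚ≡sum f) (cong (λ z → f zero + z) (sym (sumℚ≡sum (f ∘ suc))))

sumℚ-permute : ∀ {k} (π : Permutation′ k) (f : Fin k → ℚ) → sumℚ (f ∘ (π ⟨$⟩ʳ_)) ≡ sumℚ f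
sumℚ-permute π f = begin
  sumℚ (f ∘ (π ⟨$⟩ʳ_))          ≡⟨ sumℚ≡sum (f ∘ (π ⟨$⟩ʳ_)) ⟩
  FinSum.sum (f ∘ (π ⟨$⟩ʳ_))    ≡⟨ FinSum.sum-permute f π ⟨
  FinSum.sum f                 ≡⟨ sumℚ≡sum f ⟨
  sumℚ f                       ∎
  where open ≡-Reasoning

sumℚ-const : ∀ k (r : ℚ) → sumℚ {k} (λ _ → r) ≡ r * fromℕ k
sumℚ-const zero    r = sym (*-zeroʳ r)
sumℚ-const (suc k) r = begin
  sumℚ {suc k} (λ _ → r)    ≡⟨ sumℚ-suc {k} (λ _ → r) ⟩
  r + sumℚ {k} (λ _ → r)    ≡⟨ cong (λ z → r + z) (sumℚ-const k r) ⟩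
  r + r * fromℕ k           ≡⟨ solve 2 (λ x n → x :+ x :* n := x :* (con 1ℚ :+ n)) refl r (fromℕ k) ⟩
  r * (1ℚ + fromℕ k)        ≡⟨ cong (r *_) (fromℕ-suc k) ⟨
  r * fromℕ (suc k)         ∎
  where open ≡-Reasoning

permute-injective : ∀ {k} (π : Permutation′ k) {s t} → π ⟨$⟩ʳ s ≡ π ⟨$⟩ʳ t → s ≡ t
permute-injective π {s} {t} e = trans (sym (Perm.inverseˡ π)) (trans (cong (π ⟨$⟩ˡ_) e) (Perm.inverseˡ π))

sumℚ-1 : ∀ k → sumℚ {k} (λ _ → 1ℚ) ≡ fromℕ k
sumℚ-1 k = trans (sumℚ-const k 1ℚ) (*-identityˡ (fromℕ k))

δ : ∀ {k} → Fin k → Fin k → ℚ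
δ s j = if does (s ≟ᶠ j) then 1ℚ else 0ℚ

module _ {k} {s j : Fin k} where

  δ-≡ : s ≡ j → δ s j ≡ 1ℚ
  δ-≡ s≡j rewrite dec-true (s ≟ᶠ j) s≡j = refl

  δ-≢ : ¬ (s ≡ j) → δ s j ≡ 0ℚ
  δ-≢ s≢j rewrite dec-false (s ≟ᶠ j) s≢j = refl

δ-refl : ∀ {k} (s : Fin k) → δ s s ≡ 1ℚ
δ-refl s = δ-≡ {s = s} refl

δ-permute : ∀ {k} (π : Permutation′ k) (s t : Fin k) → δ (π ⟨$⟩ʳ s) (π ⟨$⟩ʳ t) ≡ δ s t
δ-permute π s t with s ≟ᶠ t
... | yes s≡t = δ-≡ (cong (π ⟨$⟩ʳ_) s≡t)
... | no  s≢t = δ-≢ (s≢t ∘ permute-injective π)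

sumℚ-δ : ∀ {k} (s : Fin k) (h : Fin k → ℚ) → sumℚ (λ j → h j * δ s j) ≡ h s
sumℚ-δ {suc k} zero h = begin
  sumℚ (λ j → h j * δ zero j)                     ≡⟨ sumℚ-suc (λ j → h j * δ zero j) ⟩
  h zero * 1ℚ + sumℚ (λ j → h (suc j) * 0ℚ)       ≡⟨ cong₂ _+_ (*-identityʳ (h zero)) rest≡0 ⟩
  h zero + 0ℚ                                     ≡⟨ +-identityʳ (h zero) ⟩
  h zero                                          ∎
  where
  open ≡-Reasoning
  rest≡0 : sumℚ (λ j → h (suc j) * 0ℚ) ≡ 0ℚ
  rest≡0 = trans (∑-cong (allFin k) (λ j → *-zeroʳ (h (suc j)))) (∑-zero (allFin k))
sumℚ-δ {suc k} (suc s) h = begin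
  sumℚ (λ j → h j * δ (suc s) j)                  ≡⟨ sumℚ-suc (λ j → h j * δ (suc s) j) ⟩
  h zero * 0ℚ + sumℚ (λ j → h (suc j) * δ s j)    ≡⟨ cong₂ _+_ (*-zeroʳ (h zero)) (sumℚ-δ s (h ∘ suc)) ⟩
  0ℚ + h (suc s)                                  ≡⟨ +-identityˡ _ ⟩
  h (suc s)                                       ∎
  where open ≡-Reasoning

sumℚ-δ≡1 : ∀ {k} (s : Fin k) → sumℚ (δ s) ≡ 1ℚ
sumℚ-δ≡1 s = trans (∑-cong (allFin _) (λ j → sym (*-identityˡ (δ s j)))) (sumℚ-δ s (λ _ → 1ℚ))

module _ {k} (i j : Fin k) where

  transpose-matchˡ : PC.transpose i j i ≡ j
  transpose-matchˡ rewrite dec-true (i ≟ᶠ i) refl = refl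

  transpose-fix : ∀ {x} → ¬ (x ≡ i) → ¬ (x ≡ j) → PC.transpose i j x ≡ x
  transpose-fix {x} x≢i x≢j rewrite dec-false (x ≟ᶠ i) x≢i | dec-false (x ≟ᶠ j) x≢j = refl

IsInjection : ∀ {m k} → Vec (Fin k) m → Set
IsInjection v = AllPairs (λ x y → ¬ (x ≡ y)) (Vec.toList v)

isInjection? : ∀ {m k} (v : Vec (Fin k) m) → Dec (IsInjection v)
isInjection? v = allPairs? (λ x y → ¬? (x ≟ᶠ y)) (Vec.toList v)

All-toList-lookup : ∀ {A : Set} {m} {P : A → Set} (v : Vec A m) → All P (Vec.toList v) → ∀ j → P (Vec.lookup v j)
All-toList-lookup (x ∷ v) (px All.∷ pv) zero    = px
All-toList-lookup (x ∷ v) (px All.∷ pv) (suc j) = All-toList-lookup v pv j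

lookup-injective : ∀ {m k} (v : Vec (Fin k) m) → IsInjection v →
  ∀ {i i′} → ¬ (i ≡ i′) → ¬ (Vec.lookup v i ≡ Vec.lookup v i′)
lookup-injective (x ∷ v) inj                  {zero}  {zero}   i≢i′ = ⊥-elim (i≢i′ refl)
lookup-injective (x ∷ v) (x∉v AllPairs.∷ inj) {zero}  {suc i′} _    = All-toList-lookup v x∉v i′
lookup-injective (x ∷ v) (x∉v AllPairs.∷ inj) {suc i} {zero}   _    = All-toList-lookup v x∉v i ∘ sym
lookup-injective (x ∷ v) (_ AllPairs.∷ inj)   {suc i} {suc i′} i≢i′ = lookup-injective v inj (i≢i′ ∘ cong suc)

isInjection-permute : ∀ {m k} (π : Permutation′ k) (v : Vec (Fin k) m) →
  does (isInjection? (Vec.map (π ⟨$⟩ʳ_) v)) ≡ does (isInjection? v)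
isInjection-permute π v = does-≡ (isInjection? (Vec.map (π ⟨$⟩ʳ_) v)) (isInjection? v) from to
  where
  does-≡ : ∀ {P Q : Set} (P? : Dec P) (Q? : Dec Q) → (P → Q) → (Q → P) → does P? ≡ does Q?
  does-≡ (yes _) (yes _) _   _   = refl
  does-≡ (yes p) (no ¬q) p→q _   = ⊥-elim (¬q (p→q p))
  does-≡ (no ¬p) (yes q) _   q→p = ⊥-elim (¬p (q→p q))
  does-≡ (no _)  (no _)  _   _   = refl
  π̂ = π ⟨$⟩ʳ_
  from : IsInjection (Vec.map π̂ v) → IsInjection v
  from inj = AllPairs.map (λ πx≢πy x≡y → πx≢πy (cong π̂ x≡y))
    (AllPairs.map⁻ (subst (AllPairs _) (Vec.toList-map π̂ v) inj))
  to : IsInjection v → IsInjection (Vec.map π̂ v)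
  to inj = subst (AllPairs _) (sym (Vec.toList-map π̂ v))
    (AllPairs.map⁺ (AllPairs.map (λ x≢y πx≡πy → x≢y (permute-injective π πx≡πy)) inj))

∑-injections : ∀ m k (g : Vec (Fin k) m → ℚ) →
  ∑ (injections m k) g ≡ ∑ (allVecs m k) (λ v → if does (isInjection? v) then g v else 0ℚ)
∑-injections m k = ∑-filter isInjection? (allVecs m k)

∑-allVecs-permute : ∀ m {k} (π : Permutation′ k) (g : Vec (Fin k) m → ℚ) →
  ∑ (allVecs m k) (g ∘ Vec.map (π ⟨$⟩ʳ_)) ≡ ∑ (allVecs m k) g
∑-allVecs-permute zero    π g = refl
∑-allVecs-permute (suc m) {k} π g = begin
  ∑ (allVecs (suc m) k) (g ∘ Vec.map π̂)                 ≡⟨ ∑-concatMap (cons m) (allFin k) (g ∘ Vec.map π̂) ⟩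
  sumℚ (λ x → ∑ (cons m x) (g ∘ Vec.map π̂))             ≡⟨ ∑-cong (allFin k) permuteTail ⟩
  sumℚ (headSum ∘ π̂)                                    ≡⟨ sumℚ-permute π headSum ⟩
  sumℚ headSum                                          ≡⟨ ∑-cong (allFin k) (λ x → ∑-map (x ∷_) (allVecs m k) g) ⟨
  sumℚ (λ x → ∑ (cons m x) g)                           ≡⟨ ∑-concatMap (cons m) (allFin k) g ⟨
  ∑ (allVecs (suc m) k) g                               ∎
  where
  open ≡-Reasoning
  π̂ = π ⟨$⟩ʳ_
  cons : ∀ m → Fin k → List (Vec (Fin k) (suc m))
  cons m x = List.map (x ∷_) (allVecs m k)
  headSum : Fin k → ℚ
  headSum y = ∑ (allVecs m k) (λ v → g (y ∷ v))
  permuteTail : ∀ x → ∑ (cons m x) (g ∘ Vec.map π̂) ≡ headSum (π̂ x)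
  permuteTail x = trans (∑-map (x ∷_) (allVecs m k) (g ∘ Vec.map π̂)) (∑-allVecs-permute m π (λ v → g (π̂ x ∷ v)))

∑-injections-permute : ∀ m k (π : Permutation′ k) (g : Vec (Fin k) m → ℚ) →
  ∑ (injections m k) (g ∘ Vec.map (π ⟨$⟩ʳ_)) ≡ ∑ (injections m k) g
∑-injections-permute m k π g = begin
  ∑ (injections m k) (g ∘ Vec.map π̂)                                              ≡⟨ ∑-injections m k (g ∘ Vec.map π̂) ⟩
  ∑ (allVecs m k) (λ v → if does (isInjection? v) then g (Vec.map π̂ v) else 0ℚ)   ≡⟨ ∑-cong (allVecs m k) restrict ⟩
  ∑ (allVecs m k) (g̃ ∘ Vec.map π̂)                                                 ≡⟨ ∑-allVecs-permute m π g̃ ⟩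
  ∑ (allVecs m k) g̃                                                               ≡⟨ ∑-injections m k g ⟨
  ∑ (injections m k) g                                                            ∎
  where
  open ≡-Reasoning
  π̂ = π ⟨$⟩ʳ_
  g̃ : Vec (Fin k) m → ℚ
  g̃ v = if does (isInjection? v) then g v else 0ℚ
  restrict : ∀ v → (if does (isInjection? v) then g (Vec.map π̂ v) else 0ℚ) ≡ g̃ (Vec.map π̂ v)
  restrict v = cong (λ b → if b then g (Vec.map π̂ v) else 0ℚ) (sym (isInjection-permute π v))

∑-injections-cong : ∀ m k {g g′ : Vec (Fin k) m → ℚ} → (∀ v → IsInjection v → g v ≡ g′ v) →
  ∑ (injections m k) g ≡ ∑ (injections m k) g′
∑-injections-cong m k {g} {g′} g≗g′ =
  trans (∑-injections m k g) (trans (∑-cong (allVecs m k) restrict) (sym (∑-injections m k g′)))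
  where
  restrict : ∀ v → (if does (isInjection? v) then g v else 0ℚ) ≡ (if does (isInjection? v) then g′ v else 0ℚ)
  restrict v with isInjection? v
  ... | yes inj = g≗g′ v inj
  ... | no  _   = refl

∑-injections-const : ∀ m k (r : ℚ) → ∑ (injections m k) (λ _ → r) ≡ r * ∑ (injections m k) (λ _ → 1ℚ)
∑-injections-const m k r =
  trans (∑-cong (injections m k) (λ _ → sym (*-identityʳ r))) (sym (*-distribˡ-∑ (injections m k) r (λ _ → 1ℚ)))

module Hits (m k′ : ℕ) where

  -- k ≥ 2 is built in so that Fin k has the distinct points zero and one.
  k : ℕ
  k = suc (suc k′)

  ∑σ : (Vec (Fin k) m → ℚ) → ℚ
  ∑σ = ∑ (injections m k)

  #inj : ℚ
  #inj = ∑σ (λ _ → 1ℚ)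

  hits : Fin m → Fin k → ℚ
  hits i j = ∑σ (λ σ → δ (Vec.lookup σ i) j)

  pairHits : Fin m → Fin m → Fin k → Fin k → ℚ
  pairHits i i′ j l = ∑σ (λ σ → δ (Vec.lookup σ i) j * δ (Vec.lookup σ i′) l)

  -- All counting below rests on one fact: relabelling [k] by a permutation maps
  -- injections bijectively onto injections.
  ∑σ-permute : ∀ (π : Permutation′ k) {g g′ : Vec (Fin k) m → ℚ} →
    (∀ σ → g (Vec.map (π ⟨$⟩ʳ_) σ) ≡ g′ σ) → ∑σ g ≡ ∑σ g′
  ∑σ-permute π {g} g∘π≗g′ = trans (sym (∑-injections-permute m k π g)) (∑-cong (injections m k) g∘π≗g′)

  δ-lookup-permute : ∀ (π : Permutation′ k) (σ : Vec (Fin k) m) i j →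
    δ (Vec.lookup (Vec.map (π ⟨$⟩ʳ_) σ) i) (π ⟨$⟩ʳ j) ≡ δ (Vec.lookup σ i) j
  δ-lookup-permute π σ i j = trans (cong (λ t → δ t (π ⟨$⟩ʳ j)) (Vec.lookup-map i (π ⟨$⟩ʳ_) σ)) (δ-permute π (Vec.lookup σ i) j)

  hits-uniform : ∀ i j → hits i j ≡ hits i zero
  hits-uniform i j = ∑σ-permute π relabel
    where
    π = Perm.transpose zero j
    relabel : ∀ σ → δ (Vec.lookup (Vec.map (π ⟨$⟩ʳ_) σ) i) j ≡ δ (Vec.lookup σ i) zero
    relabel σ = trans (cong (δ (Vec.lookup (Vec.map (π ⟨$⟩ʳ_) σ) i)) (sym (transpose-matchˡ zero j)))
      (δ-lookup-permute π σ i zero)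

  ∑σ-lookup : ∀ i (h : Fin k → ℚ) → ∑σ (λ σ → h (Vec.lookup σ i)) ≡ hits i zero * sumℚ h
  ∑σ-lookup i h = begin
    ∑σ (λ σ → h (Vec.lookup σ i))                         ≡⟨ ∑-cong (injections m k) (λ σ → sym (sumℚ-δ (Vec.lookup σ i) h)) ⟩
    ∑σ (λ σ → sumℚ (λ j → h j * δ (Vec.lookup σ i) j))    ≡⟨ ∑-comm (injections m k) (allFin k) _ ⟩
    sumℚ (λ j → ∑σ (λ σ → h j * δ (Vec.lookup σ i) j))    ≡⟨ ∑-cong (allFin k) (λ j → sym (*-distribˡ-∑ (injections m k) (h j) _)) ⟩
    sumℚ (λ j → h j * hits i j)                           ≡⟨ ∑-cong (allFin k) (λ j → cong (h j *_) (hits-uniform i j)) ⟩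
    sumℚ (λ j → h j * hits i zero)                        ≡⟨ *-distribʳ-∑ (allFin k) (hits i zero) h ⟨
    sumℚ h * hits i zero                                  ≡⟨ *-comm (sumℚ h) (hits i zero) ⟩
    hits i zero * sumℚ h                                  ∎
    where open ≡-Reasoning

  #inj≡hits*k : ∀ i → #inj ≡ hits i zero * fromℕ k
  #inj≡hits*k i = trans (∑σ-lookup i (λ _ → 1ℚ)) (cong (hits i zero *_) (sumℚ-1 k))

  one : Fin k
  one = suc zero

  pairHits-permute : ∀ (π : Permutation′ k) i i′ j l → pairHits i i′ (π ⟨$⟩ʳ j) (π ⟨$⟩ʳ l) ≡ pairHits i i′ j l
  pairHits-permute π i i′ j l = ∑σ-permute π (λ σ → cong₂ _*_ (δ-lookup-permute π σ i j) (δ-lookup-permute π σ i′ l))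

  pairHits-diagonal : ∀ {i i′} → ¬ (i ≡ i′) → ∀ j → pairHits i i′ j j ≡ 0ℚ
  pairHits-diagonal {i} {i′} i≢i′ j = trans (∑-injections-cong m k vanish) (∑-zero (injections m k))
    where
    vanish : ∀ σ → IsInjection σ → δ (Vec.lookup σ i) j * δ (Vec.lookup σ i′) j ≡ 0ℚ
    vanish σ inj = by-cases (Vec.lookup σ i ≟ᶠ j)
      where
      by-cases : Dec (Vec.lookup σ i ≡ j) → δ (Vec.lookup σ i) j * δ (Vec.lookup σ i′) j ≡ 0ℚ
      by-cases (no  σi≢j) = trans (cong (_* δ (Vec.lookup σ i′) j) (δ-≢ σi≢j)) (*-zeroˡ (δ (Vec.lookup σ i′) j))
      by-cases (yes σi≡j) = trans (cong (δ (Vec.lookup σ i) j *_) (δ-≢ σi′≢j)) (*-zeroʳ (δ (Vec.lookup σ i) j))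
        where
        σi′≢j : ¬ (Vec.lookup σ i′ ≡ j)
        σi′≢j σi′≡j = lookup-injective σ inj i≢i′ (trans σi≡j (sym σi′≡j))

  pairHits-offDiagonal : ∀ i i′ {j l} → ¬ (j ≡ l) → pairHits i i′ j l ≡ pairHits i i′ zero one
  pairHits-offDiagonal i i′ {j} {l} j≢l = begin
    pairHits i i′ j l                                 ≡⟨ pairHits-permute π i i′ j l ⟨
    pairHits i i′ (π ⟨$⟩ʳ j) l′                        ≡⟨ cong (λ t → pairHits i i′ t l′) (transpose-matchˡ j zero) ⟩
    pairHits i i′ zero l′                             ≡⟨ pairHits-permute ρ i i′ zero l′ ⟨
    pairHits i i′ (ρ ⟨$⟩ʳ zero) (ρ ⟨$⟩ʳ l′)            ≡⟨ cong₂ (pairHits i i′) (transpose-fix l′ one (l′≢0 ∘ sym) (λ ())) (transpose-matchˡ l′ one) ⟩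
    pairHits i i′ zero one                            ∎
    where
    open ≡-Reasoning
    π = Perm.transpose j zero
    l′ = π ⟨$⟩ʳ l
    ρ = Perm.transpose l′ one
    l′≢0 : ¬ (l′ ≡ zero)
    l′≢0 l′≡0 = j≢l (sym (permute-injective π (trans l′≡0 (sym (transpose-matchˡ j zero)))))

  pairHits-form : ∀ {i i′} → ¬ (i ≡ i′) → ∀ j l → pairHits i i′ j l ≡ pairHits i i′ zero one * (1ℚ - δ j l)
  pairHits-form {i} {i′} i≢i′ j l = by-cases (j ≟ᶠ l)
    where
    G = pairHits i i′ zero one
    by-cases : Dec (j ≡ l) → pairHits i i′ j l ≡ G * (1ℚ - δ j l)
    by-cases (yes refl) = trans (pairHits-diagonal i≢i′ j) (sym (trans (cong (λ d → G * (1ℚ - d)) (δ-refl j)) (*-zeroʳ G)))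
    by-cases (no  j≢l)  = trans (pairHits-offDiagonal i i′ j≢l) (sym (trans (cong (λ d → G * (1ℚ - d)) (δ-≢ j≢l)) (*-identityʳ G)))

  pairHits-row : ∀ i i′ j → sumℚ (pairHits i i′ j) ≡ hits i j
  pairHits-row i i′ j = begin
    sumℚ (pairHits i i′ j)                                          ≡⟨ ∑-comm (injections m k) (allFin k) _ ⟨
    ∑σ (λ σ → sumℚ (λ l → δ (Vec.lookup σ i) j * δ (Vec.lookup σ i′) l))  ≡⟨ ∑-cong (injections m k) collapse ⟩
    hits i j                                                        ∎
    where
    open ≡-Reasoning
    collapse : ∀ σ → sumℚ (λ l → δ (Vec.lookup σ i) j * δ (Vec.lookup σ i′) l) ≡ δ (Vec.lookup σ i) j
    collapse σ = trans (sym (*-distribˡ-∑ (allFin k) (δ (Vec.lookup σ i) j) (δ (Vec.lookup σ i′))))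
      (trans (cong (δ (Vec.lookup σ i) j *_) (sumℚ-δ≡1 (Vec.lookup σ i′))) (*-identityʳ _))

  pairHits01-*-k-1 : ∀ {i i′} → ¬ (i ≡ i′) → pairHits i i′ zero one * (fromℕ k - 1ℚ) ≡ hits i zero
  pairHits01-*-k-1 {i} {i′} i≢i′ = begin
    G * (fromℕ k - 1ℚ)                              ≡⟨ cong₂ (λ a b → G * (a - b)) (sumℚ-1 k) (sumℚ-δ≡1 {k} zero) ⟨
    G * (sumℚ {k} (λ _ → 1ℚ) - sumℚ (δ {k} zero))       ≡⟨ cong (G *_) (∑-distrib-minus (allFin k) (λ _ → 1ℚ) (δ {k} zero)) ⟨
    G * sumℚ {k} (λ l → 1ℚ - δ zero l)                  ≡⟨ *-distribˡ-∑ (allFin k) G (λ l → 1ℚ - δ zero l) ⟩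
    sumℚ {k} (λ l → G * (1ℚ - δ zero l))                ≡⟨ ∑-cong (allFin k) (pairHits-form i≢i′ zero) ⟨
    sumℚ (pairHits i i′ zero)                       ≡⟨ pairHits-row i i′ zero ⟩
    hits i zero                                     ∎
    where
    open ≡-Reasoning
    G = pairHits i i′ zero one

sqNorm : ∀ {k} → (Fin k → ℚ) → ℚ
sqNorm x = sumℚ (λ j → x j * x j)

module Covariance (m k′ : ℕ) where

  open Hits m k′

  ∑σ-lookup-pair : ∀ i i′ (x y : Fin k → ℚ) →
    ∑σ (λ σ → x (Vec.lookup σ i) * y (Vec.lookup σ i′)) ≡ sumℚ (λ j → sumℚ (λ l → (x j * y l) * pairHits i i′ j l))
  ∑σ-lookup-pair i i′ x y = begin
    ∑σ (λ σ → x (σ ! i) * y (σ ! i′))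
      ≡⟨ ∑-cong (injections m k) (λ σ → cong₂ _*_ (sym (sumℚ-δ (σ ! i) x)) (sym (sumℚ-δ (σ ! i′) y))) ⟩
    ∑σ (λ σ → sumℚ (λ j → x j * δ (σ ! i) j) * sumℚ (λ l → y l * δ (σ ! i′) l))
      ≡⟨ ∑-cong (injections m k) (λ σ → ∑*∑ (allFin k) (allFin k) (λ j → x j * δ (σ ! i) j) (λ l → y l * δ (σ ! i′) l)) ⟩
    ∑σ (λ σ → sumℚ (λ j → sumℚ (λ l → term σ j l)))
      ≡⟨ ∑-comm (injections m k) (allFin k) _ ⟩
    sumℚ (λ j → ∑σ (λ σ → sumℚ (λ l → term σ j l)))
      ≡⟨ ∑-cong (allFin k) (λ j → ∑-comm (injections m k) (allFin k) (λ σ l → term σ j l)) ⟩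
    sumℚ (λ j → sumℚ (λ l → ∑σ (λ σ → term σ j l)))
      ≡⟨ ∑-cong (allFin k) (λ j → ∑-cong (allFin k) (λ l → factor j l)) ⟩
    sumℚ (λ j → sumℚ (λ l → (x j * y l) * pairHits i i′ j l))
      ∎
    where
    open ≡-Reasoning
    _!_ = Vec.lookup
    term : Vec (Fin k) m → Fin k → Fin k → ℚ
    term σ j l = (x j * δ (σ ! i) j) * (y l * δ (σ ! i′) l)
    factor : ∀ j l → ∑σ (λ σ → term σ j l) ≡ (x j * y l) * pairHits i i′ j l
    factor j l = trans
      (∑-cong (injections m k) (λ σ → solve 4 (λ a b c d → (a :* b) :* (c :* d) := (a :* c) :* (b :* d)) refl
        (x j) (δ (σ ! i) j) (y l) (δ (σ ! i′) l)))
      (sym (*-distribˡ-∑ (injections m k) (x j * y l) _))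

  ∑σ-lookup-pair-centred : ∀ {i i′} → ¬ (i ≡ i′) → ∀ (x : Fin k → ℚ) → sumℚ x ≡ 0ℚ →
    ∑σ (λ σ → x (Vec.lookup σ i) * x (Vec.lookup σ i′)) ≡ - (pairHits i i′ zero one * sqNorm x)
  ∑σ-lookup-pair-centred {i} {i′} i≢i′ x ∑x≡0 = begin
    ∑σ (λ σ → x (Vec.lookup σ i) * x (Vec.lookup σ i′))       ≡⟨ ∑σ-lookup-pair i i′ x x ⟩
    sumℚ (λ j → sumℚ (λ l → (x j * x l) * pairHits i i′ j l))  ≡⟨ ∑-cong (allFin k) row ⟩
    sumℚ (λ j → - (G * (x j * x j)))                          ≡⟨ neg-distrib-∑ (allFin k) (λ j → G * (x j * x j)) ⟨
    - sumℚ (λ j → G * (x j * x j))                            ≡⟨ cong -_ (*-distribˡ-∑ (allFin k) G (λ j → x j * x j)) ⟨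
    - (G * sqNorm x)                                          ∎
    where
    open ≡-Reasoning
    G = pairHits i i′ zero one
    row : ∀ j → sumℚ (λ l → (x j * x l) * pairHits i i′ j l) ≡ - (G * (x j * x j))
    row j = begin
      sumℚ (λ l → (x j * x l) * pairHits i i′ j l)       ≡⟨ ∑-cong (allFin k) (λ l → cong ((x j * x l) *_) (pairHits-form i≢i′ j l)) ⟩
      sumℚ (λ l → (x j * x l) * (G * (1ℚ - δ j l)))      ≡⟨ ∑-cong (allFin k) (λ l → solve 4
                                                            (λ a b g d → (a :* b) :* (g :* (con 1ℚ :- d)) := (a :* g) :* (b :- b :* d)) refl
                                                            (x j) (x l) G (δ j l)) ⟩
      sumℚ (λ l → (x j * G) * (x l - x l * δ j l))       ≡⟨ *-distribˡ-∑ (allFin k) (x j * G) (λ l → x l - x l * δ j l) ⟨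
      (x j * G) * sumℚ (λ l → x l - x l * δ j l)         ≡⟨ cong ((x j * G) *_) (∑-distrib-minus (allFin k) x (λ l → x l * δ j l)) ⟩
      (x j * G) * (sumℚ x - sumℚ (λ l → x l * δ j l))    ≡⟨ cong₂ (λ a b → (x j * G) * (a - b)) ∑x≡0 (sumℚ-δ j x) ⟩
      (x j * G) * (0ℚ - x j)                             ≡⟨ solve 2 (λ a g → (a :* g) :* (con 0ℚ :- a) := :- (g :* (a :* a))) refl (x j) G ⟩
      - (G * (x j * x j))                                ∎

  κ : ℚ
  κ = fromℕ k * (fromℕ k - 1ℚ)

  covariance : ∀ (x : Fin k → ℚ) → sumℚ x ≡ 0ℚ → ∀ i i′ →
    κ * ∑σ (λ σ → x (Vec.lookup σ i) * x (Vec.lookup σ i′)) ≡ #inj * sqNorm x * (fromℕ k * δ i i′ - 1ℚ)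
  covariance x ∑x≡0 i i′ = by-cases (i ≟ᶠ i′)
    where
    open ≡-Reasoning
    K = fromℕ k
    S = sqNorm x
    W = hits i zero
    by-cases : Dec (i ≡ i′) → κ * ∑σ (λ σ → x (Vec.lookup σ i) * x (Vec.lookup σ i′)) ≡ #inj * S * (K * δ i i′ - 1ℚ)
    by-cases (yes refl) = begin
      κ * ∑σ (λ σ → x (Vec.lookup σ i) * x (Vec.lookup σ i))  ≡⟨ cong (κ *_) (∑σ-lookup i (λ j → x j * x j)) ⟩
      K * (K - 1ℚ) * (W * S)                                 ≡⟨ solve 3 (λ k w s → k :* (k :- con 1ℚ) :* (w :* s) := (w :* k) :* s :* (k :* con 1ℚ :- con 1ℚ)) refl K W S ⟩
      (W * K) * S * (K * 1ℚ - 1ℚ)                            ≡⟨ cong₂ (λ a d → a * S * (K * d - 1ℚ)) (#inj≡hits*k i) (δ-refl i) ⟨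
      #inj * S * (K * δ i i - 1ℚ)                            ∎
    by-cases (no i≢i′) = begin
      κ * ∑σ (λ σ → x (Vec.lookup σ i) * x (Vec.lookup σ i′))  ≡⟨ cong (κ *_) (∑σ-lookup-pair-centred i≢i′ x ∑x≡0) ⟩
      K * (K - 1ℚ) * (- (G * S))                              ≡⟨ solve 3 (λ k g s → k :* (k :- con 1ℚ) :* (:- (g :* s)) := (g :* (k :- con 1ℚ)) :* k :* s :* (k :* con 0ℚ :- con 1ℚ)) refl K G S ⟩
      (G * (K - 1ℚ)) * K * S * (K * 0ℚ - 1ℚ)                  ≡⟨ cong₂ (λ a d → a * K * S * (K * d - 1ℚ)) (pairHits01-*-k-1 i≢i′) (sym (δ-≢ i≢i′)) ⟩
      W * K * S * (K * δ i i′ - 1ℚ)                           ≡⟨ cong (λ a → a * S * (K * δ i i′ - 1ℚ)) (#inj≡hits*k i) ⟨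
      #inj * S * (K * δ i i′ - 1ℚ)                            ∎
      where G = pairHits i i′ zero one

module WeightedMoments (m k′ : ℕ) (w : Fin m → ℚ) where

  open Hits m k′
  open Covariance m k′

  linear : (Fin k → ℚ) → Vec (Fin k) m → ℚ
  linear x σ = sumℚ (λ i → w i * x (Vec.lookup σ i))

  quadratic : (Fin k → ℚ) → Vec (Fin k) m → ℚ
  quadratic x σ = sumℚ (λ i → w i * (x (Vec.lookup σ i) * x (Vec.lookup σ i)))

  ν₁ ν₂ Γ : ℚ
  ν₁ = sumℚ w
  ν₂ = sqNorm w
  Γ  = fromℕ k * ν₂ - ν₁ * ν₁ - (fromℕ k - 1ℚ) * ν₁

  ∑σ-linear : ∀ (x : Fin k → ℚ) → sumℚ x ≡ 0ℚ → ∑σ (linear x) ≡ 0ℚ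
  ∑σ-linear x ∑x≡0 = begin
    ∑σ (linear x)                                        ≡⟨ ∑-comm (injections m k) (allFin m) _ ⟩
    sumℚ (λ i → ∑σ (λ σ → w i * x (Vec.lookup σ i)))     ≡⟨ ∑-cong (allFin m) coordinate ⟩
    sumℚ {m} (λ _ → 0ℚ)                                  ≡⟨ ∑-zero (allFin m) ⟩
    0ℚ                                                   ∎
    where
    open ≡-Reasoning
    coordinate : ∀ i → ∑σ (λ σ → w i * x (Vec.lookup σ i)) ≡ 0ℚ
    coordinate i = begin
      ∑σ (λ σ → w i * x (Vec.lookup σ i))    ≡⟨ *-distribˡ-∑ (injections m k) (w i) _ ⟨
      w i * ∑σ (λ σ → x (Vec.lookup σ i))    ≡⟨ cong (w i *_) (∑σ-lookup i x) ⟩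
      w i * (hits i zero * sumℚ x)           ≡⟨ cong (λ s → w i * (hits i zero * s)) ∑x≡0 ⟩
      w i * (hits i zero * 0ℚ)               ≡⟨ solve 2 (λ a b → a :* (b :* con 0ℚ) := con 0ℚ) refl (w i) (hits i zero) ⟩
      0ℚ                                     ∎

  ∑σ-quadratic : ∀ (x : Fin k → ℚ) → κ * ∑σ (quadratic x) ≡ (fromℕ k - 1ℚ) * #inj * sqNorm x * ν₁
  ∑σ-quadratic x = begin
    κ * ∑σ (quadratic x)                                     ≡⟨ cong (κ *_) (∑-comm (injections m k) (allFin m) _) ⟩
    κ * sumℚ (λ i → ∑σ (λ σ → w i * x² (Vec.lookup σ i)))   ≡⟨ *-distribˡ-∑ (allFin m) κ _ ⟩
    sumℚ (λ i → κ * ∑σ (λ σ → w i * x² (Vec.lookup σ i)))   ≡⟨ ∑-cong (allFin m) coordinate ⟩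
    sumℚ (λ i → C * w i)                                     ≡⟨ *-distribˡ-∑ (allFin m) C w ⟨
    C * ν₁                                                   ∎
    where
    open ≡-Reasoning
    K = fromℕ k
    x² : Fin k → ℚ
    x² j = x j * x j
    C = (K - 1ℚ) * #inj * sqNorm x
    coordinate : ∀ i → κ * ∑σ (λ σ → w i * x² (Vec.lookup σ i)) ≡ C * w i
    coordinate i = begin
      κ * ∑σ (λ σ → w i * x² (Vec.lookup σ i))    ≡⟨ cong (κ *_) (*-distribˡ-∑ (injections m k) (w i) _) ⟨
      κ * (w i * ∑σ (λ σ → x² (Vec.lookup σ i)))  ≡⟨ cong (λ s → κ * (w i * s)) (∑σ-lookup i x²) ⟩
      K * (K - 1ℚ) * (w i * (W * sqNorm x))       ≡⟨ solve 4 (λ k a h s → k :* (k :- con 1ℚ) :* (a :* (h :* s)) := (k :- con 1ℚ) :* (h :* k) :* s :* a) refl K (w i) W (sqNorm x) ⟩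
      (K - 1ℚ) * (W * K) * sqNorm x * w i         ≡⟨ cong (λ t → (K - 1ℚ) * t * sqNorm x * w i) (#inj≡hits*k i) ⟨
      C * w i                                     ∎
      where W = hits i zero

  ∑σ-linear² : ∀ (x : Fin k → ℚ) → sumℚ x ≡ 0ℚ →
    κ * ∑σ (λ σ → linear x σ * linear x σ) ≡ #inj * sqNorm x * (fromℕ k * ν₂ - ν₁ * ν₁)
  ∑σ-linear² x ∑x≡0 = begin
    κ * ∑σ (λ σ → linear x σ * linear x σ)
      ≡⟨ cong (κ *_) (∑-cong (injections m k) (λ σ → ∑*∑ (allFin m) (allFin m) (wx σ) (wx σ))) ⟩
    κ * ∑σ (λ σ → sumℚ (λ i → sumℚ (λ i′ → wx σ i * wx σ i′)))
      ≡⟨ cong (κ *_) (trans (∑-comm (injections m k) (allFin m) _) (∑-cong (allFin m) (λ i → ∑-comm (injections m k) (allFin m) _))) ⟩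
    κ * sumℚ (λ i → sumℚ (λ i′ → ∑σ (λ σ → wx σ i * wx σ i′)))
      ≡⟨ trans (*-distribˡ-∑ (allFin m) κ _) (∑-cong (allFin m) (λ i → *-distribˡ-∑ (allFin m) κ _)) ⟩
    sumℚ (λ i → sumℚ (λ i′ → κ * ∑σ (λ σ → wx σ i * wx σ i′)))
      ≡⟨ ∑-cong (allFin m) (λ i → ∑-cong (allFin m) (pair i)) ⟩
    sumℚ (λ i → sumℚ (λ i′ → (IS * w i) * (w i′ * (K * δ i i′ - 1ℚ))))
      ≡⟨ ∑-cong (allFin m) (λ i → trans (sym (*-distribˡ-∑ (allFin m) (IS * w i) _)) (cong (IS * w i *_) (row i))) ⟩
    sumℚ (λ i → IS * w i * (K * w i - ν₁))
      ≡⟨ ∑-cong (allFin m) (λ i → solve 4 (λ c a k n → c :* a :* (k :* a :- n) := c :* (k :* (a :* a) :- n :* a)) refl IS (w i) K ν₁) ⟩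
    sumℚ (λ i → IS * (K * (w i * w i) - ν₁ * w i))
      ≡⟨ *-distribˡ-∑ (allFin m) IS _ ⟨
    IS * sumℚ (λ i → K * (w i * w i) - ν₁ * w i)
      ≡⟨ cong (IS *_) (trans (∑-distrib-minus (allFin m) _ _) (sym (cong₂ _-_ (*-distribˡ-∑ (allFin m) K _) (*-distribˡ-∑ (allFin m) ν₁ w)))) ⟩
    IS * (K * ν₂ - ν₁ * ν₁)
      ∎
    where
    open ≡-Reasoning
    K = fromℕ k
    IS = #inj * sqNorm x
    wx : Vec (Fin k) m → Fin m → ℚ
    wx σ i = w i * x (Vec.lookup σ i)
    pair : ∀ i i′ → κ * ∑σ (λ σ → wx σ i * wx σ i′) ≡ (IS * w i) * (w i′ * (K * δ i i′ - 1ℚ))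
    pair i i′ = begin
      κ * ∑σ (λ σ → wx σ i * wx σ i′)
        ≡⟨ cong (κ *_) (∑-cong (injections m k) (λ σ → solve 4 (λ a u b v → (a :* u) :* (b :* v) := (a :* b) :* (u :* v)) refl
             (w i) (x (Vec.lookup σ i)) (w i′) (x (Vec.lookup σ i′)))) ⟩
      κ * ∑σ (λ σ → (w i * w i′) * (x (Vec.lookup σ i) * x (Vec.lookup σ i′)))
        ≡⟨ cong (κ *_) (*-distribˡ-∑ (injections m k) (w i * w i′) _) ⟨
      κ * ((w i * w i′) * ∑σ (λ σ → x (Vec.lookup σ i) * x (Vec.lookup σ i′)))
        ≡⟨ solve 3 (λ a b c → a :* (b :* c) := b :* (a :* c)) refl κ (w i * w i′) _ ⟩
      (w i * w i′) * (κ * ∑σ (λ σ → x (Vec.lookup σ i) * x (Vec.lookup σ i′)))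
        ≡⟨ cong ((w i * w i′) *_) (covariance x ∑x≡0 i i′) ⟩
      (w i * w i′) * (IS * (K * δ i i′ - 1ℚ))
        ≡⟨ solve 4 (λ a b c e → (a :* b) :* (c :* e) := (c :* a) :* (b :* e)) refl (w i) (w i′) IS (K * δ i i′ - 1ℚ) ⟩
      (IS * w i) * (w i′ * (K * δ i i′ - 1ℚ))
        ∎
    row : ∀ i → sumℚ (λ i′ → w i′ * (K * δ i i′ - 1ℚ)) ≡ K * w i - ν₁
    row i = begin
      sumℚ (λ i′ → w i′ * (K * δ i i′ - 1ℚ))
        ≡⟨ ∑-cong (allFin m) (λ i′ → solve 3 (λ a k d → a :* (k :* d :- con 1ℚ) := k :* (a :* d) :- a) refl (w i′) K (δ i i′)) ⟩
      sumℚ (λ i′ → K * (w i′ * δ i i′) - w i′)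
        ≡⟨ ∑-distrib-minus (allFin m) (λ i′ → K * (w i′ * δ i i′)) w ⟩
      sumℚ (λ i′ → K * (w i′ * δ i i′)) - ν₁
        ≡⟨ cong (_- ν₁) (trans (sym (*-distribˡ-∑ (allFin m) K (λ i′ → w i′ * δ i i′))) (cong (K *_) (sumℚ-δ i w))) ⟩
      K * w i - ν₁
        ∎

  ∑σ-linear²-quadratic : ∀ (x : Fin k → ℚ) → sumℚ x ≡ 0ℚ →
    κ * (∑σ (λ σ → linear x σ * linear x σ) - ∑σ (quadratic x)) ≡ #inj * sqNorm x * Γ
  ∑σ-linear²-quadratic x ∑x≡0 = begin
    κ * (∑σ LL - ∑σ (quadratic x))                   ≡⟨ solve 3 (λ a b c → a :* (b :- c) := a :* b :- a :* c) refl κ (∑σ LL) (∑σ (quadratic x)) ⟩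
    κ * ∑σ LL - κ * ∑σ (quadratic x)                 ≡⟨ cong₂ _-_ (∑σ-linear² x ∑x≡0) (∑σ-quadratic x) ⟩
    IS * (K * ν₂ - ν₁ * ν₁) - (K - 1ℚ) * #inj * sqNorm x * ν₁
      ≡⟨ solve 6 (λ a s k t n o → a :* s :* (k :* t :- n :* n) :- (k :- o) :* a :* s :* n := a :* s :* (k :* t :- n :* n :- (k :- o) :* n))
           refl #inj (sqNorm x) K ν₂ ν₁ 1ℚ ⟩
    IS * Γ                                           ∎
    where
    open ≡-Reasoning
    K = fromℕ k
    IS = #inj * sqNorm x
    LL : Vec (Fin k) m → ℚ
    LL σ = linear x σ * linear x σ

∏ : List ℚ → ℚ
∏ = List.foldr _*_ 1ℚ

pairs : ℕ → ℕ
pairs zero    = zero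
pairs (suc n) = n ℕ.+ pairs n

cubicConstant : ℕ → ℕ
cubicConstant zero    = zero
cubicConstant (suc n) = pairs n ℕ.+ (cubicConstant n ℕ.+ cubicConstant n)

-- ∏ bs = ∏ (c + (b - c)) expanded by order in the deviations b - c; the recursive
-- definitions make the closed forms of the first two orders and the cubic bound on
-- the remainder provable by induction on the list.
module SecondOrder (c : ℚ) where

  linearPart : List ℚ → ℚ
  linearPart []       = 0ℚ
  linearPart (b ∷ bs) = (b - c) * c ^ℚ List.length bs + c * linearPart bs

  quadraticPart : List ℚ → ℚ
  quadraticPart []       = 0ℚ
  quadraticPart (b ∷ bs) = (b - c) * linearPart bs + c * quadraticPart bs

  remainder : List ℚ → ℚ
  remainder bs = ∏ bs - c ^ℚ List.length bs - linearPart bs - quadraticPart bs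

  ∑Δ ∑Δ² : List ℚ → ℚ
  ∑Δ  bs = ∑ bs (λ b → b - c)
  ∑Δ² bs = ∑ bs (λ b → (b - c) * (b - c))

  ∏-expansion : ∀ bs → ∏ bs ≡ c ^ℚ List.length bs + linearPart bs + quadraticPart bs + remainder bs
  ∏-expansion bs = solve 4 (λ p a b d → p := a :+ b :+ d :+ (p :- a :- b :- d)) refl
    (∏ bs) (c ^ℚ List.length bs) (linearPart bs) (quadraticPart bs)

  c*linearPart : ∀ bs → c * linearPart bs ≡ c ^ℚ List.length bs * ∑Δ bs
  c*linearPart []       = trans (*-zeroʳ c) (sym (*-zeroʳ 1ℚ))
  c*linearPart (b ∷ bs) = begin
    c * ((b - c) * cᴺ + c * linearPart bs)     ≡⟨ solve 4 (λ c b n e → c :* ((b :- c) :* n :+ c :* e) := c :* n :* (b :- c) :+ c :* (c :* e)) refl c b cᴺ (linearPart bs) ⟩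
    c * cᴺ * (b - c) + c * (c * linearPart bs) ≡⟨ cong (λ z → c * cᴺ * (b - c) + c * z) (c*linearPart bs) ⟩
    c * cᴺ * (b - c) + c * (cᴺ * ∑Δ bs)        ≡⟨ solve 4 (λ c b n l → c :* n :* (b :- c) :+ c :* (n :* l) := c :* n :* ((b :- c) :+ l)) refl c b cᴺ (∑Δ bs) ⟩
    c * cᴺ * ((b - c) + ∑Δ bs)                 ∎
    where
    open ≡-Reasoning
    cᴺ = c ^ℚ List.length bs

  2c²*quadraticPart : ∀ bs → c * c * quadraticPart bs + c * c * quadraticPart bs ≡ c ^ℚ List.length bs * (∑Δ bs * ∑Δ bs - ∑Δ² bs)
  2c²*quadraticPart []       = trans (solve 1 (λ c → c :* c :* con 0ℚ :+ c :* c :* con 0ℚ := con 0ℚ) refl c) (sym (*-zeroʳ 1ℚ))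
  2c²*quadraticPart (b ∷ bs) = begin
    c * c * ((b - c) * E₁ + c * E₂) + c * c * ((b - c) * E₁ + c * E₂)
      ≡⟨ solve 4 (λ c b e f → c :* c :* ((b :- c) :* e :+ c :* f) :+ c :* c :* ((b :- c) :* e :+ c :* f)
                            := (c :* (b :- c) :+ c :* (b :- c)) :* (c :* e) :+ c :* (c :* c :* f :+ c :* c :* f)) refl c b E₁ E₂ ⟩
    (c * (b - c) + c * (b - c)) * (c * E₁) + c * (c * c * E₂ + c * c * E₂)
      ≡⟨ cong₂ (λ u v → (c * (b - c) + c * (b - c)) * u + c * v) (c*linearPart bs) (2c²*quadraticPart bs) ⟩
    (c * (b - c) + c * (b - c)) * (cᴺ * L) + c * (cᴺ * (L * L - Q))
      ≡⟨ solve 5 (λ c b n l q → (c :* (b :- c) :+ c :* (b :- c)) :* (n :* l) :+ c :* (n :* (l :* l :- q))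
                              := c :* n :* (((b :- c) :+ l) :* ((b :- c) :+ l) :- ((b :- c) :* (b :- c) :+ q))) refl c b cᴺ L Q ⟩
    c * cᴺ * (((b - c) + L) * ((b - c) + L) - ((b - c) * (b - c) + Q))
      ∎
    where
    open ≡-Reasoning
    cᴺ = c ^ℚ List.length bs
    E₁ = linearPart bs
    E₂ = quadraticPart bs
    L  = ∑Δ bs
    Q  = ∑Δ² bs

  remainder-∷ : ∀ b bs → remainder (b ∷ bs) ≡ (b - c) * quadraticPart bs + b * remainder bs
  remainder-∷ b bs = solve 6
    (λ b c p n e f → b :* p :- c :* n :- ((b :- c) :* n :+ c :* e) :- ((b :- c) :* e :+ c :* f) := (b :- c) :* f :+ b :* (p :- n :- e :- f))
    refl b c (∏ bs) (c ^ℚ List.length bs) (linearPart bs) (quadraticPart bs)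

  module _ (0≤c : 0ℚ ≤ c) (c≤1 : c ≤ 1ℚ) {D : ℚ} (D≤1 : D ≤ 1ℚ) where

    private
      ∣c∣≤1 : ∣ c ∣ ≤ 1ℚ
      ∣c∣≤1 = subst (_≤ 1ℚ) (sym (0≤p⇒∣p∣≡p 0≤c)) c≤1

      ∣cᴺ∣≤1 : ∀ n → ∣ c ^ℚ n ∣ ≤ 1ℚ
      ∣cᴺ∣≤1 n = subst (_≤ 1ℚ) (sym (0≤p⇒∣p∣≡p (0≤^ℚ 0≤c n))) (^ℚ≤1 0≤c c≤1 n)

      ∣b∣≤2 : ∀ {b} → ∣ b - c ∣ ≤ D → ∣ b ∣ ≤ 1ℚ + 1ℚ
      ∣b∣≤2 {b} ∣b-c∣≤D = subst (λ t → ∣ t ∣ ≤ 1ℚ + 1ℚ) (solve 2 (λ b c → c :+ (b :- c) := b) refl b c)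
        (∣p+q∣≤a+b ∣c∣≤1 (≤-trans ∣b-c∣≤D D≤1))

    ∣linearPart∣≤ : ∀ bs → All (λ b → ∣ b - c ∣ ≤ D) bs → ∣ linearPart bs ∣ ≤ fromℕ (List.length bs) * D
    ∣linearPart∣≤ []       _ = ≤-reflexive (sym (*-zeroˡ D))
    ∣linearPart∣≤ (b ∷ bs) (∣b-c∣≤D All.∷ near) = begin
      ∣ (b - c) * c ^ℚ N + c * linearPart bs ∣    ≤⟨ ∣p+q∣≤a+b (∣p*q∣≤a*b ∣b-c∣≤D (∣cᴺ∣≤1 N)) (∣p*q∣≤a*b ∣c∣≤1 (∣linearPart∣≤ bs near)) ⟩
      D * 1ℚ + 1ℚ * (fromℕ N * D)                ≡⟨ solve 2 (λ d n → d :* con 1ℚ :+ con 1ℚ :* (n :* d) := (con 1ℚ :+ n) :* d) refl D (fromℕ N) ⟩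
      (1ℚ + fromℕ N) * D                         ≡⟨ cong (_* D) (fromℕ-suc N) ⟨
      fromℕ (suc N) * D                          ∎
      where
      open ≤-Reasoning
      N = List.length bs

    ∣quadraticPart∣≤ : ∀ bs → All (λ b → ∣ b - c ∣ ≤ D) bs → ∣ quadraticPart bs ∣ ≤ fromℕ (pairs (List.length bs)) * (D * D)
    ∣quadraticPart∣≤ []       _ = ≤-reflexive (sym (*-zeroˡ (D * D)))
    ∣quadraticPart∣≤ (b ∷ bs) (∣b-c∣≤D All.∷ near) = begin
      ∣ (b - c) * linearPart bs + c * quadraticPart bs ∣
        ≤⟨ ∣p+q∣≤a+b (∣p*q∣≤a*b ∣b-c∣≤D (∣linearPart∣≤ bs near)) (∣p*q∣≤a*b ∣c∣≤1 (∣quadraticPart∣≤ bs near)) ⟩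
      D * (fromℕ N * D) + 1ℚ * (fromℕ (pairs N) * (D * D))
        ≡⟨ solve 3 (λ d n e → d :* (n :* d) :+ con 1ℚ :* (e :* (d :* d)) := (n :+ e) :* (d :* d)) refl D (fromℕ N) (fromℕ (pairs N)) ⟩
      (fromℕ N + fromℕ (pairs N)) * (D * D)
        ≡⟨ cong (_* (D * D)) (fromℕ-+ N (pairs N)) ⟨
      fromℕ (pairs (suc N)) * (D * D)
        ∎
      where
      open ≤-Reasoning
      N = List.length bs

    ∣remainder∣≤ : ∀ bs → All (λ b → ∣ b - c ∣ ≤ D) bs → ∣ remainder bs ∣ ≤ fromℕ (cubicConstant (List.length bs)) * (D * D * D)
    ∣remainder∣≤ []       _ = ≤-reflexive (trans (cong ∣_∣ (solve 0 (con 1ℚ :- con 1ℚ :- con 0ℚ :- con 0ℚ := con 0ℚ) refl)) (sym (*-zeroˡ (D * D * D))))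
    ∣remainder∣≤ (b ∷ bs) (∣b-c∣≤D All.∷ near) = begin
      ∣ remainder (b ∷ bs) ∣
        ≡⟨ cong ∣_∣ (remainder-∷ b bs) ⟩
      ∣ (b - c) * quadraticPart bs + b * remainder bs ∣
        ≤⟨ ∣p+q∣≤a+b (∣p*q∣≤a*b ∣b-c∣≤D (∣quadraticPart∣≤ bs near)) (∣p*q∣≤a*b (∣b∣≤2 {b} ∣b-c∣≤D) (∣remainder∣≤ bs near)) ⟩
      D * (P * (D * D)) + (1ℚ + 1ℚ) * (T * (D * D * D))
        ≡⟨ solve 3 (λ d p t → d :* (p :* (d :* d)) :+ (con 1ℚ :+ con 1ℚ) :* (t :* (d :* d :* d)) := (p :+ (t :+ t)) :* (d :* d :* d)) refl D P T ⟩
      (P + (T + T)) * (D * D * D)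
        ≡⟨ cong (_* (D * D * D)) (trans (fromℕ-+ (pairs N) (cubicConstant N ℕ.+ cubicConstant N)) (cong (λ t → P + t) (fromℕ-+ (cubicConstant N) (cubicConstant N)))) ⟨
      fromℕ (cubicConstant (suc N)) * (D * D * D)
        ∎
      where
      open ≤-Reasoning
      N = List.length bs
      P = fromℕ (pairs N)
      T = fromℕ (cubicConstant N)

module _ {A : Set} where

  sup : List A → (A → ℚ) → ℚ
  sup l f = List.foldr _⊔_ 0ℚ (List.map f l)

  ≤-sup : ∀ {l : List A} (f : A → ℚ) {a} → a ∈ l → f a ≤ sup l f
  ≤-sup {a ∷ l} f (here refl) = p≤p⊔q (f a) (sup l f)
  ≤-sup {a ∷ l} f (there a∈l) = ≤-trans (≤-sup f a∈l) (p≤q⊔p (f a) (sup l f))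

  0≤sup : ∀ (l : List A) (f : A → ℚ) → 0ℚ ≤ sup l f
  0≤sup []      f = ≤-refl
  0≤sup (a ∷ l) f = ≤-trans (0≤sup l f) (p≤q⊔p (f a) (sup l f))

  sup-< : ∀ (l : List A) (f : A → ℚ) {ε} → 0ℚ < ε → (∀ a → f a < ε) → sup l f < ε
  sup-< []      f 0<ε f<ε = 0<ε
  sup-< (a ∷ l) f 0<ε f<ε with ⊔-sel (f a) (sup l f)
  ... | inj₁ ⊔≡fa  = subst (_< _) (sym ⊔≡fa) (f<ε a)
  ... | inj₂ ⊔≡sup = subst (_< _) (sym ⊔≡sup) (sup-< l f 0<ε f<ε)

  sup∣∣²≤∑² : ∀ (l : List A) (x : A → ℚ) → sup l (λ a → ∣ x a ∣) * sup l (λ a → ∣ x a ∣) ≤ ∑ l (λ a → x a * x a)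
  sup∣∣²≤∑² []      x = ≤-reflexive (*-zeroˡ 0ℚ)
  sup∣∣²≤∑² (a ∷ l) x with ⊔-sel ∣ x a ∣ (sup l (λ a → ∣ x a ∣))
  ... | inj₁ ⊔≡∣xa∣ = subst (λ t → t * t ≤ x a * x a + ∑ l x²) (sym ⊔≡∣xa∣) (begin
    ∣ x a ∣ * ∣ x a ∣       ≡⟨ ∣p∣*∣p∣≡p*p (x a) ⟩
    x a * x a              ≡⟨ +-identityʳ _ ⟨
    x a * x a + 0ℚ         ≤⟨ +-monoʳ-≤ (x a * x a) (0≤∑ l (λ b → 0≤p*p (x b))) ⟩
    x a * x a + ∑ l x²     ∎)
    where
    open ≤-Reasoning
    x² = λ b → x b * x b
  ... | inj₂ ⊔≡sup = subst (λ t → t * t ≤ x a * x a + ∑ l x²) (sym ⊔≡sup) (begin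
    sup l (λ b → ∣ x b ∣) * sup l (λ b → ∣ x b ∣)  ≤⟨ sup∣∣²≤∑² l x ⟩
    ∑ l x²                                       ≡⟨ +-identityˡ _ ⟨
    0ℚ + ∑ l x²                                  ≤⟨ +-monoˡ-≤ (∑ l x²) (0≤p*p (x a)) ⟩
    x a * x a + ∑ l x²                           ∎)
    where
    open ≤-Reasoning
    x² = λ b → x b * x b

module _ {A Λ S D T R Γ : ℚ} (0<A : 0ℚ < A) (0≤Λ : 0ℚ ≤ Λ) (D²≤S : D * D ≤ S)
         (A*T≡ΛSΓ : A * T ≡ Λ * S * Γ) (A∣R∣≤ΛD² : A * ∣ R ∣ ≤ Λ * (D * D)) where

  private
    0≤ΛS : 0ℚ ≤ Λ * S
    0≤ΛS = 0≤* 0≤Λ (≤-trans (0≤p*p D) D²≤S)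

    A*[T+R] : A * (T + R) ≡ Λ * S * Γ + A * R
    A*[T+R] = trans (*-distribˡ-+ A T R) (cong (_+ A * R) A*T≡ΛSΓ)

    0≤Λ[S-D²] : 0ℚ ≤ Λ * (S - D * D)
    0≤Λ[S-D²] = 0≤* 0≤Λ (subst (_≤ S - D * D) (+-inverseʳ (D * D)) (+-monoˡ-≤ (- (D * D)) D²≤S))

  quadratic-dominates-≤0 : Γ ≤ - 1ℚ → T + R ≤ 0ℚ
  quadratic-dominates-≤0 Γ≤-1 = *-cancelˡ-≤-0< 0<A (begin
    A * (T + R)                       ≡⟨ A*[T+R] ⟩
    Λ * S * Γ + A * R                 ≤⟨ +-mono-≤ (*-monoˡ-≤-0≤ 0≤ΛS Γ≤-1) (≤-trans (*-monoˡ-≤-0≤ (<⇒≤ 0<A) (p≤∣p∣ R)) A∣R∣≤ΛD²) ⟩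
    Λ * S * - 1ℚ + Λ * (D * D)        ≡⟨ solve 3 (λ l s d → l :* s :* (:- con 1ℚ) :+ l :* (d :* d) := :- (l :* (s :- d :* d))) refl Λ S D ⟩
    - (Λ * (S - D * D))               ≤⟨ neg-antimono-≤ 0≤Λ[S-D²] ⟩
    - 0ℚ                              ≡⟨ *-zeroʳ A ⟨
    A * 0ℚ                            ∎)
    where open ≤-Reasoning

  quadratic-dominates-≥0 : 1ℚ ≤ Γ → 0ℚ ≤ T + R
  quadratic-dominates-≥0 1≤Γ = *-cancelˡ-≤-0< 0<A (begin
    A * 0ℚ                            ≡⟨ *-zeroʳ A ⟩
    0ℚ                                ≤⟨ 0≤Λ[S-D²] ⟩
    Λ * (S - D * D)                   ≡⟨ solve 3 (λ l s d → l :* (s :- d :* d) := l :* s :* con 1ℚ :+ (:- (l :* (d :* d)))) refl Λ S D ⟩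
    Λ * S * 1ℚ + - (Λ * (D * D))      ≤⟨ +-mono-≤ (*-monoˡ-≤-0≤ 0≤ΛS 1≤Γ) (≤-trans (neg-antimono-≤ A∣R∣≤ΛD²) -A∣R∣≤AR) ⟩
    Λ * S * Γ + A * R                 ≡⟨ A*[T+R] ⟨
    A * (T + R)                       ∎)
    where
    open ≤-Reasoning
    -A∣R∣≤AR : - (A * ∣ R ∣) ≤ A * R
    -A∣R∣≤AR = subst (_≤ A * R) (sym (neg-distribʳ-* A ∣ R ∣))
      (*-monoˡ-≤-0≤ (<⇒≤ 0<A) (∣p∣≤r⇒-r≤p ≤-refl))

∏-++ : ∀ bs bs′ → ∏ (bs ++ bs′) ≡ ∏ bs * ∏ bs′
∏-++ []       bs′ = sym (*-identityˡ _)
∏-++ (b ∷ bs) bs′ = trans (cong (b *_) (∏-++ bs bs′)) (sym (*-assoc b (∏ bs) (∏ bs′)))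

∏-replicate : ∀ e v → ∏ (List.replicate e v) ≡ v ^ℚ e
∏-replicate zero    v = refl
∏-replicate (suc e) v = cong (v *_) (∏-replicate e v)

∑-replicate : ∀ e v (f : ℚ → ℚ) → ∑ (List.replicate e v) f ≡ fromℕ e * f v
∑-replicate zero    v f = sym (*-zeroˡ (f v))
∑-replicate (suc e) v f = begin
  f v + ∑ (List.replicate e v) f   ≡⟨ cong (λ z → f v + z) (∑-replicate e v f) ⟩
  f v + fromℕ e * f v              ≡⟨ solve 2 (λ a b → a :+ b :* a := (con 1ℚ :+ b) :* a) refl (f v) (fromℕ e) ⟩
  (1ℚ + fromℕ e) * f v             ≡⟨ cong (_* f v) (fromℕ-suc e) ⟨
  fromℕ (suc e) * f v              ∎
  where open ≡-Reasoning

module _ {A : Set} (e : A → ℕ) (v : A → ℚ) where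

  repeated : List A → List ℚ
  repeated = concatMap (λ a → List.replicate (e a) (v a))

  length-repeated : ∀ l → List.length (repeated l) ≡ List.foldr ℕ._+_ 0 (List.map e l)
  length-repeated []      = refl
  length-repeated (a ∷ l) = trans (List.length-++ (List.replicate (e a) (v a)))
    (cong₂ ℕ._+_ (List.length-replicate (e a)) (length-repeated l))

  ∏-repeated : ∀ l → ∏ (repeated l) ≡ List.foldr _*_ 1ℚ (List.map (λ a → v a ^ℚ e a) l)
  ∏-repeated []      = refl
  ∏-repeated (a ∷ l) = trans (∏-++ (List.replicate (e a) (v a)) (repeated l))
    (cong₂ _*_ (∏-replicate (e a) (v a)) (∏-repeated l))

  ∑-repeated : ∀ l (f : ℚ → ℚ) → ∑ (repeated l) f ≡ ∑ l (λ a → fromℕ (e a) * f (v a))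
  ∑-repeated l f = trans (∑-concatMap _ l f) (∑-cong l (λ a → ∑-replicate (e a) (v a) f))

  All-repeated : ∀ {P : ℚ → Set} → (∀ a → P (v a)) → ∀ l → All P (repeated l)
  All-repeated Pv l = All.concat⁺ (All.map⁺ (All.universal (λ a → All.replicate⁺ (e a) (Pv a)) l))

∏-^ℚ : ∀ {A : Set} (c : ℚ) (e : A → ℕ) l →
  List.foldr _*_ 1ℚ (List.map (λ a → c ^ℚ e a) l) ≡ c ^ℚ List.foldr ℕ._+_ 0 (List.map e l)
∏-^ℚ c e []      = refl
∏-^ℚ c e (a ∷ l) = trans (cong (c ^ℚ e a *_) (∏-^ℚ c e l)) (sym (^ℚ-+ (e a) _))

module Expansion (m k′ : ℕ) (μ : Fin m → ℕ) where

  open Hits m k′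
  open Covariance m k′ using (κ)
  open WeightedMoments m k′ (fromℕ ∘ μ)

  -- U k j reduces to c, so Near ε (U k) p unfolds to ∀ j → ∣ x p j ∣ < ε.
  c : ℚ
  c = + 1 / k

  c*k≡1 : c * fromℕ k ≡ 1ℚ
  c*k≡1 = 1/suc-*-fromℕ (suc k′)

  n : ℕ
  n = sumℕ μ

  open SecondOrder c

  factors : (Fin k → ℚ) → Vec (Fin k) m → List ℚ
  factors p σ = repeated μ (λ i → p (Vec.lookup σ i)) (allFin m)

  length-factors : ∀ p σ → List.length (factors p σ) ≡ n
  length-factors p σ = length-repeated μ (λ i → p (Vec.lookup σ i)) (allFin m)

  β-uniform : β k μ (U k) ≡ c ^ℚ n * #inj
  β-uniform = trans (∑-cong (injections m k) (λ _ → ∏-^ℚ c μ (allFin m))) (∑-injections-const m k (c ^ℚ n))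

  0≤c : 0ℚ ≤ c
  0≤c = <⇒≤ (0<1/suc (suc k′))

  c≤1 : c ≤ 1ℚ
  c≤1 = 1/suc≤1 (suc k′)

  module _ (p : Fin k → ℚ) where

    x : Fin k → ℚ
    x j = p j - c

    E₁ E₂ R : Vec (Fin k) m → ℚ
    E₁ σ = linearPart (factors p σ)
    E₂ σ = quadraticPart (factors p σ)
    R  σ = remainder (factors p σ)

    β-expansion : β k μ p ≡ ∑σ (λ σ → c ^ℚ n + E₁ σ + E₂ σ + R σ)
    β-expansion = ∑-cong (injections m k) λ σ → begin
      prodℚ (λ i → p (Vec.lookup σ i) ^ℚ μ i)                ≡⟨ ∏-repeated μ (λ i → p (Vec.lookup σ i)) (allFin m) ⟨
      ∏ (factors p σ)                                       ≡⟨ ∏-expansion (factors p σ) ⟩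
      c ^ℚ List.length (factors p σ) + E₁ σ + E₂ σ + R σ     ≡⟨ cong (λ N → c ^ℚ N + E₁ σ + E₂ σ + R σ) (length-factors p σ) ⟩
      c ^ℚ n + E₁ σ + E₂ σ + R σ                             ∎
      where open ≡-Reasoning

    ∑Δ-factors : ∀ σ → ∑Δ (factors p σ) ≡ linear x σ
    ∑Δ-factors σ = ∑-repeated μ (λ i → p (Vec.lookup σ i)) (allFin m) (λ b → b - c)

    ∑Δ²-factors : ∀ σ → ∑Δ² (factors p σ) ≡ quadratic x σ
    ∑Δ²-factors σ = ∑-repeated μ (λ i → p (Vec.lookup σ i)) (allFin m) (λ b → (b - c) * (b - c))

    ∑σ-linearPart : sumℚ x ≡ 0ℚ → ∑σ E₁ ≡ 0ℚ
    ∑σ-linearPart ∑x≡0 = begin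
      ∑σ E₁                                   ≡⟨ *-identityˡ (∑σ E₁) ⟨
      1ℚ * ∑σ E₁                              ≡⟨ cong (_* ∑σ E₁) c*k≡1 ⟨
      c * K * ∑σ E₁                           ≡⟨ solve 3 (λ a b e → a :* b :* e := b :* (a :* e)) refl c K (∑σ E₁) ⟩
      K * (c * ∑σ E₁)                         ≡⟨ cong (K *_) (*-distribˡ-∑ (injections m k) c E₁) ⟩
      K * ∑σ (λ σ → c * E₁ σ)                 ≡⟨ cong (K *_) (∑-cong (injections m k) c*E₁) ⟩
      K * ∑σ (λ σ → c ^ℚ n * linear x σ)      ≡⟨ cong (K *_) (*-distribˡ-∑ (injections m k) (c ^ℚ n) (linear x)) ⟨
      K * (c ^ℚ n * ∑σ (linear x))            ≡⟨ cong (λ t → K * (c ^ℚ n * t)) (∑σ-linear x ∑x≡0) ⟩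
      K * (c ^ℚ n * 0ℚ)                       ≡⟨ solve 2 (λ a b → a :* (b :* con 0ℚ) := con 0ℚ) refl K (c ^ℚ n) ⟩
      0ℚ                                      ∎
      where
      open ≡-Reasoning
      K = fromℕ k
      c*E₁ : ∀ σ → c * E₁ σ ≡ c ^ℚ n * linear x σ
      c*E₁ σ = trans (c*linearPart (factors p σ))
        (cong₂ (λ N s → c ^ℚ N * s) (length-factors p σ) (∑Δ-factors σ))

    ∑σ-quadraticPart : sumℚ x ≡ 0ℚ → (c + c) * (fromℕ k - 1ℚ) * ∑σ E₂ ≡ c ^ℚ n * #inj * sqNorm x * Γ
    ∑σ-quadraticPart ∑x≡0 = begin
      (c + c) * (K - 1ℚ) * ∑σ E₂                ≡⟨ *-identityʳ _ ⟨
      (c + c) * (K - 1ℚ) * ∑σ E₂ * 1ℚ           ≡⟨ cong ((c + c) * (K - 1ℚ) * ∑σ E₂ *_) c*k≡1 ⟨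
      (c + c) * (K - 1ℚ) * ∑σ E₂ * (c * K)      ≡⟨ solve 3 (λ c k t → (c :+ c) :* (k :- con 1ℚ) :* t :* (c :* k) := k :* (k :- con 1ℚ) :* ((c :* c :+ c :* c) :* t)) refl c K (∑σ E₂) ⟩
      κ * ((c * c + c * c) * ∑σ E₂)             ≡⟨ cong (κ *_) 2c²∑σE₂ ⟩
      κ * (c ^ℚ n * (∑σ LL - ∑σ (quadratic x))) ≡⟨ solve 3 (λ a b d → a :* (b :* d) := b :* (a :* d)) refl κ (c ^ℚ n) _ ⟩
      c ^ℚ n * (κ * (∑σ LL - ∑σ (quadratic x))) ≡⟨ cong (c ^ℚ n *_) (∑σ-linear²-quadratic x ∑x≡0) ⟩
      c ^ℚ n * (#inj * sqNorm x * Γ)            ≡⟨ solve 4 (λ a b d e → a :* (b :* d :* e) := a :* b :* d :* e) refl (c ^ℚ n) #inj (sqNorm x) Γ ⟩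
      c ^ℚ n * #inj * sqNorm x * Γ              ∎
      where
      open ≡-Reasoning
      K = fromℕ k
      LL : Vec (Fin k) m → ℚ
      LL σ = linear x σ * linear x σ
      2c²E₂ : ∀ σ → (c * c + c * c) * E₂ σ ≡ c ^ℚ n * (LL σ - quadratic x σ)
      2c²E₂ σ = trans (*-distribʳ-+ (E₂ σ) (c * c) (c * c)) (trans (2c²*quadraticPart (factors p σ))
        (cong₂ (λ N s → c ^ℚ N * s) (length-factors p σ) (cong₂ (λ a b → a * a - b) (∑Δ-factors σ) (∑Δ²-factors σ))))
      2c²∑σE₂ : (c * c + c * c) * ∑σ E₂ ≡ c ^ℚ n * (∑σ LL - ∑σ (quadratic x))
      2c²∑σE₂ = begin
        (c * c + c * c) * ∑σ E₂                       ≡⟨ *-distribˡ-∑ (injections m k) (c * c + c * c) E₂ ⟩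
        ∑σ (λ σ → (c * c + c * c) * E₂ σ)             ≡⟨ ∑-cong (injections m k) 2c²E₂ ⟩
        ∑σ (λ σ → c ^ℚ n * (LL σ - quadratic x σ))    ≡⟨ *-distribˡ-∑ (injections m k) (c ^ℚ n) _ ⟨
        c ^ℚ n * ∑σ (λ σ → LL σ - quadratic x σ)      ≡⟨ cong (c ^ℚ n *_) (∑-distrib-minus (injections m k) LL (quadratic x)) ⟩
        c ^ℚ n * (∑σ LL - ∑σ (quadratic x))           ∎

    ∣∑σ-remainder∣≤ : ∀ {D} → D ≤ 1ℚ → (∀ j → ∣ x j ∣ ≤ D) → ∣ ∑σ R ∣ ≤ fromℕ (cubicConstant n) * (D * D * D) * #inj
    ∣∑σ-remainder∣≤ {D} D≤1 ∣x∣≤D = begin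
      ∣ ∑σ R ∣                                        ≤⟨ ∣∑∣≤∑∣∣ (injections m k) R ⟩
      ∑σ (λ σ → ∣ R σ ∣)                              ≤⟨ ∑-mono-≤ (injections m k) bound ⟩
      ∑σ (λ _ → fromℕ (cubicConstant n) * (D * D * D))      ≡⟨ ∑-injections-const m k _ ⟩
      fromℕ (cubicConstant n) * (D * D * D) * #inj          ∎
      where
      open ≤-Reasoning
      bound : ∀ σ → ∣ R σ ∣ ≤ fromℕ (cubicConstant n) * (D * D * D)
      bound σ = subst (λ N → ∣ R σ ∣ ≤ fromℕ (cubicConstant N) * (D * D * D)) (length-factors p σ)
        (∣remainder∣≤ 0≤c c≤1 D≤1 (factors p σ) (All-repeated μ (λ i → p (Vec.lookup σ i)) (λ i → ∣x∣≤D (Vec.lookup σ i)) (allFin m)))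

module LocalExtremum (m k′ : ℕ) (μ : Fin m → ℕ) where

  open Hits m k′
  open WeightedMoments m k′ (fromℕ ∘ μ) using (Γ)
  open Expansion m k′ μ

  K : ℚ
  K = fromℕ (cubicConstant n)

  M : ℕ
  M = cubicConstant n ℕ.+ cubicConstant n

  r : ℚ
  r = + 1 / suc M

  -- Chosen so that A * (K * D) ≤ cⁿ when D ≤ ε, which lets the quadratic term
  -- absorb the cubic remainder.
  ε : ℚ
  ε = c ^ℚ n * r

  0<ε : 0ℚ < ε
  0<ε = 0<* (0<^ℚ (0<1/suc (suc k′)) n) (0<1/suc M)

  ε≤1 : ε ≤ 1ℚ
  ε≤1 = ≤-trans (*-mono-≤-0≤ (0≤^ℚ 0≤c n) (<⇒≤ (0<1/suc M)) (^ℚ≤1 0≤c c≤1 n) (1/suc≤1 M)) (≤-reflexive (*-identityˡ 1ℚ))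

  A : ℚ
  A = (c + c) * (fromℕ k - 1ℚ)

  0<A : 0ℚ < A
  0<A = 0<* (+-mono-< (0<1/suc (suc k′)) (0<1/suc (suc k′))) (begin-strict
    0ℚ                   <⟨ 0<1/suc 0 ⟩
    1ℚ                   ≡⟨ solve 0 (con 1ℚ := con (fromℕ 2) :- con 1ℚ) refl ⟩
    fromℕ 2 - 1ℚ         ≤⟨ +-monoˡ-≤ (- 1ℚ) (fromℕ-mono-≤ {2} {k} (ℕ.s≤s (ℕ.s≤s ℕ.z≤n))) ⟩
    fromℕ k - 1ℚ         ∎)
    where open ≤-Reasoning

  A*K*D≤cⁿ : ∀ {D} → 0ℚ ≤ D → D ≤ ε → A * (K * D) ≤ c ^ℚ n
  A*K*D≤cⁿ {D} 0≤D D≤ε = begin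
    A * (K * D)                   ≤⟨ *-monoʳ-≤-0≤ (0≤* (0≤fromℕ (cubicConstant n)) 0≤D) A≤2 ⟩
    (1ℚ + 1ℚ) * (K * D)           ≤⟨ *-monoˡ-≤-0≤ (0≤fromℕ 2) (*-monoˡ-≤-0≤ (0≤fromℕ (cubicConstant n)) D≤ε) ⟩
    (1ℚ + 1ℚ) * (K * ε)           ≡⟨ solve 3 (λ k a r → (con 1ℚ :+ con 1ℚ) :* (k :* (a :* r)) := a :* ((k :+ k) :* r)) refl K (c ^ℚ n) r ⟩
    c ^ℚ n * ((K + K) * r)        ≤⟨ *-monoˡ-≤-0≤ (0≤^ℚ 0≤c n) [K+K]*r≤1 ⟩
    c ^ℚ n * 1ℚ                   ≡⟨ *-identityʳ _ ⟩
    c ^ℚ n                        ∎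
    where
    open ≤-Reasoning
    A≤2 : A ≤ 1ℚ + 1ℚ
    A≤2 = begin
      (c + c) * (fromℕ k - 1ℚ)                  ≡⟨ solve 2 (λ c k → (c :+ c) :* (k :- con 1ℚ) := c :* k :+ c :* k :- (c :+ c)) refl c (fromℕ k) ⟩
      c * fromℕ k + c * fromℕ k - (c + c)       ≡⟨ cong (λ t → t + t - (c + c)) c*k≡1 ⟩
      1ℚ + 1ℚ - (c + c)                         ≤⟨ +-monoʳ-≤ (1ℚ + 1ℚ) (neg-antimono-≤ (+-mono-≤ 0≤c 0≤c)) ⟩
      1ℚ + 1ℚ - (0ℚ + 0ℚ)                       ≡⟨ solve 0 (con 1ℚ :+ con 1ℚ :- (con 0ℚ :+ con 0ℚ) := con 1ℚ :+ con 1ℚ) refl ⟩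
      1ℚ + 1ℚ                                   ∎
    [K+K]*r≤1 : (K + K) * r ≤ 1ℚ
    [K+K]*r≤1 = begin
      (K + K) * r          ≡⟨ cong (_* r) (fromℕ-+ (cubicConstant n) (cubicConstant n)) ⟨
      fromℕ M * r          ≤⟨ *-monoʳ-≤-0≤ (<⇒≤ (0<1/suc M)) (fromℕ-mono-≤ (ℕ.n≤1+n M)) ⟩
      fromℕ (suc M) * r    ≡⟨ *-comm _ r ⟩
      r * fromℕ (suc M)    ≡⟨ 1/suc-*-fromℕ M ⟩
      1ℚ                   ∎

  module _ {p : Fin k → ℚ} (∑p≡1 : sumℚ p ≡ 1ℚ) (near : ∀ j → ∣ x p j ∣ < ε) where

    ∑x≡0 : sumℚ (x p) ≡ 0ℚ
    ∑x≡0 = begin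
      sumℚ (x p)                      ≡⟨ ∑-distrib-minus (allFin k) p (λ _ → c) ⟩
      sumℚ p - sumℚ {k} (λ _ → c)     ≡⟨ cong₂ _-_ ∑p≡1 (trans (sumℚ-const k c) c*k≡1) ⟩
      1ℚ - 1ℚ                         ≡⟨ +-inverseʳ 1ℚ ⟩
      0ℚ                              ∎
      where open ≡-Reasoning

    D : ℚ
    D = sup (allFin k) (λ j → ∣ x p j ∣)

    0≤D : 0ℚ ≤ D
    0≤D = 0≤sup (allFin k) (λ j → ∣ x p j ∣)

    D≤ε : D ≤ ε
    D≤ε = <⇒≤ (sup-< (allFin k) (λ j → ∣ x p j ∣) 0<ε near)

    β-decomposition : β k μ p ≡ β k μ (U k) + (∑σ (E₂ p) + ∑σ (R p))
    β-decomposition = begin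
      β k μ p
        ≡⟨ β-expansion p ⟩
      ∑σ (λ σ → c ^ℚ n + E₁ p σ + E₂ p σ + R p σ)
        ≡⟨ ∑-distrib-+ (injections m k) _ (R p) ⟩
      ∑σ (λ σ → c ^ℚ n + E₁ p σ + E₂ p σ) + ∑σ (R p)
        ≡⟨ cong (_+ ∑σ (R p)) (∑-distrib-+ (injections m k) _ (E₂ p)) ⟩
      ∑σ (λ σ → c ^ℚ n + E₁ p σ) + ∑σ (E₂ p) + ∑σ (R p)
        ≡⟨ cong (λ t → t + ∑σ (E₂ p) + ∑σ (R p)) (∑-distrib-+ (injections m k) (λ _ → c ^ℚ n) (E₁ p)) ⟩
      ∑σ (λ _ → c ^ℚ n) + ∑σ (E₁ p) + ∑σ (E₂ p) + ∑σ (R p)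
        ≡⟨ cong₂ (λ a b → a + b + ∑σ (E₂ p) + ∑σ (R p)) (trans (∑-injections-const m k (c ^ℚ n)) (sym β-uniform)) (∑σ-linearPart p ∑x≡0) ⟩
      β k μ (U k) + 0ℚ + ∑σ (E₂ p) + ∑σ (R p)
        ≡⟨ solve 3 (λ b t s → b :+ con 0ℚ :+ t :+ s := b :+ (t :+ s)) refl (β k μ (U k)) (∑σ (E₂ p)) (∑σ (R p)) ⟩
      β k μ (U k) + (∑σ (E₂ p) + ∑σ (R p))
        ∎
      where open ≡-Reasoning

    A∣∑σR∣≤ : A * ∣ ∑σ (R p) ∣ ≤ c ^ℚ n * #inj * (D * D)
    A∣∑σR∣≤ = begin
      A * ∣ ∑σ (R p) ∣                ≤⟨ *-monoˡ-≤-0≤ (<⇒≤ 0<A) (∣∑σ-remainder∣≤ p (≤-trans D≤ε ε≤1) ∣x∣≤D) ⟩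
      A * (K * (D * D * D) * #inj)    ≡⟨ solve 4 (λ a k d i → a :* (k :* (d :* d :* d) :* i) := a :* (k :* d) :* i :* (d :* d)) refl A K D #inj ⟩
      A * (K * D) * #inj * (D * D)    ≤⟨ *-monoʳ-≤-0≤ (0≤p*p D) (*-monoʳ-≤-0≤ 0≤#inj (A*K*D≤cⁿ 0≤D D≤ε)) ⟩
      c ^ℚ n * #inj * (D * D)         ∎
      where
      open ≤-Reasoning
      ∣x∣≤D : ∀ j → ∣ x p j ∣ ≤ D
      ∣x∣≤D j = ≤-sup (λ j → ∣ x p j ∣) (∈-allFin j)
      0≤#inj : 0ℚ ≤ #inj
      0≤#inj = 0≤∑ (injections m k) (λ _ → 0≤fromℕ 1)

    private
      0≤cⁿ#inj : 0ℚ ≤ c ^ℚ n * #inj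
      0≤cⁿ#inj = 0≤* (0≤^ℚ 0≤c n) (0≤∑ (injections m k) (λ _ → 0≤fromℕ 1))

      D²≤S : D * D ≤ sqNorm (x p)
      D²≤S = sup∣∣²≤∑² (allFin k) (x p)

    β≤β[U] : Γ ≤ - 1ℚ → β k μ p ≤ β k μ (U k)
    β≤β[U] Γ≤-1 = begin
      β k μ p                                    ≡⟨ β-decomposition ⟩
      β k μ (U k) + (∑σ (E₂ p) + ∑σ (R p))       ≤⟨ +-monoʳ-≤ (β k μ (U k)) (quadratic-dominates-≤0 {D = D} 0<A 0≤cⁿ#inj D²≤S (∑σ-quadraticPart p ∑x≡0) A∣∑σR∣≤ Γ≤-1) ⟩
      β k μ (U k) + 0ℚ                           ≡⟨ +-identityʳ _ ⟩
      β k μ (U k)                                ∎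
      where open ≤-Reasoning

    β[U]≤β : 1ℚ ≤ Γ → β k μ (U k) ≤ β k μ p
    β[U]≤β 1≤Γ = begin
      β k μ (U k)                                ≡⟨ +-identityʳ _ ⟨
      β k μ (U k) + 0ℚ                           ≤⟨ +-monoʳ-≤ (β k μ (U k)) (quadratic-dominates-≥0 {D = D} 0<A 0≤cⁿ#inj D²≤S (∑σ-quadraticPart p ∑x≡0) A∣∑σR∣≤ 1≤Γ) ⟩
      β k μ (U k) + (∑σ (E₂ p) + ∑σ (R p))       ≡⟨ β-decomposition ⟨
      β k μ p                                    ∎
      where open ≤-Reasoning

  isLocalMax : Γ ≤ - 1ℚ → IsLocalMax (β k μ) (U k)
  isLocalMax Γ≤-1 = ε , 0<ε , λ p (_ , ∑p≡1) near → β≤β[U] {p} ∑p≡1 near Γ≤-1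

  isLocalMin : 1ℚ ≤ Γ → IsLocalMin (β k μ) (U k)
  isLocalMin 1≤Γ = ε , 0<ε , λ p (_ , ∑p≡1) near → β[U]≤β {p} ∑p≡1 near 1≤Γ

fromℕ-sumℕ : ∀ {m} (f : Fin m → ℕ) → fromℕ (sumℕ f) ≡ sumℚ (fromℕ ∘ f)
fromℕ-sumℕ {m} f = go (allFin m)
  where
  go : ∀ l → fromℕ (List.foldr ℕ._+_ 0 (List.map f l)) ≡ ∑ l (fromℕ ∘ f)
  go []      = refl
  go (a ∷ l) = trans (fromℕ-+ (f a) _) (cong (λ t → fromℕ (f a) + t) (go l))

sumℕ-mono-≤ : ∀ {m} {f g : Fin m → ℕ} → (∀ i → f i ℕ.≤ g i) → sumℕ f ℕ.≤ sumℕ g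
sumℕ-mono-≤ {m} {f} {g} f≤g = go (allFin m)
  where
  go : ∀ l → List.foldr ℕ._+_ 0 (List.map f l) ℕ.≤ List.foldr ℕ._+_ 0 (List.map g l)
  go []      = ℕ.z≤n
  go (a ∷ l) = ℕ.+-mono-≤ (f≤g a) (go l)

suc≤⇒fromℕ-fromℕ≤-1 : ∀ {a b} → suc a ℕ.≤ b → fromℕ a - fromℕ b ≤ - 1ℚ
suc≤⇒fromℕ-fromℕ≤-1 {a} {b} 1+a≤b = begin
  fromℕ a - fromℕ b                ≡⟨ solve 2 (λ x y → x :- y := (con 1ℚ :+ x) :- y :- con 1ℚ) refl (fromℕ a) (fromℕ b) ⟩
  (1ℚ + fromℕ a) - fromℕ b - 1ℚ    ≤⟨ +-monoˡ-≤ (- 1ℚ) (+-monoˡ-≤ (- fromℕ b) (subst (_≤ fromℕ b) (fromℕ-suc a) (fromℕ-mono-≤ 1+a≤b))) ⟩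
  fromℕ b - fromℕ b - 1ℚ           ≡⟨ solve 1 (λ y → y :- y :- con 1ℚ := :- con 1ℚ) refl (fromℕ b) ⟩
  - 1ℚ                             ∎
  where open ≤-Reasoning

suc≤⇒1≤fromℕ-fromℕ : ∀ {a b} → suc b ℕ.≤ a → 1ℚ ≤ fromℕ a - fromℕ b
suc≤⇒1≤fromℕ-fromℕ {a} {b} 1+b≤a = begin
  1ℚ                               ≡⟨ solve 1 (λ y → con 1ℚ := (con 1ℚ :+ y) :- y) refl (fromℕ b) ⟩
  (1ℚ + fromℕ b) - fromℕ b         ≤⟨ +-monoˡ-≤ (- fromℕ b) (subst (_≤ fromℕ a) (fromℕ-suc b) (fromℕ-mono-≤ 1+b≤a)) ⟩
  fromℕ a - fromℕ b                ∎
  where open ≤-Reasoning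

Υ-cases : ∀ {m} (μ : Fin m → ℕ) →
  (sumℕ (λ i → μ i ℕ.* μ i) ℕ.∸ sumℕ μ ≡ 0 × Υ μ ≡ ∞) ⊎
  Σ ℕ (λ d → sumℕ (λ i → μ i ℕ.* μ i) ℕ.∸ sumℕ μ ≡ suc d × Υ μ ≡ fin (+ (sumℕ μ ℕ.* sumℕ μ ℕ.∸ sumℕ μ) / suc d))
Υ-cases μ with sumℕ (λ i → μ i ℕ.* μ i) ℕ.∸ sumℕ μ
... | zero  = inj₁ (refl , refl)
... | suc d = inj₂ (d , refl , refl)

fromℕ-∸ : ∀ {a b} → b ℕ.≤ a → fromℕ (a ℕ.∸ b) ≡ fromℕ a - fromℕ b
fromℕ-∸ {a} {b} b≤a = begin
  fromℕ (a ℕ.∸ b)                          ≡⟨ solve 2 (λ d y → d := (y :+ d) :- y) refl (fromℕ (a ℕ.∸ b)) (fromℕ b) ⟩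
  (fromℕ b + fromℕ (a ℕ.∸ b)) - fromℕ b    ≡⟨ cong (_- fromℕ b) (fromℕ-+ b (a ℕ.∸ b)) ⟨
  fromℕ (b ℕ.+ (a ℕ.∸ b)) - fromℕ b        ≡⟨ cong (λ t → fromℕ t - fromℕ b) (ℕ.m+[n∸m]≡n b≤a) ⟩
  fromℕ a - fromℕ b                        ∎
  where open ≡-Reasoning

sumℕ-1 : ∀ m → sumℕ {m} (λ _ → 1) ≡ m
sumℕ-1 m = trans (count (allFin m)) (List.length-tabulate (λ i → i))
  where
  count : ∀ {A : Set} (l : List A) → List.foldr ℕ._+_ 0 (List.map (λ _ → 1) l) ≡ List.length l
  count []      = refl
  count (_ ∷ l) = cong suc (count l)

module Threshold (m k′ : ℕ) (μ : Fin m → ℕ) (2≤m : 2 ℕ.≤ m) (1≤μ : ∀ i → 1 ℕ.≤ μ i) where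

  open Hits m k′ using (k)
  open WeightedMoments m k′ (fromℕ ∘ μ) using (Γ)

  n s₂ : ℕ
  n  = sumℕ μ
  s₂ = sumℕ (λ i → μ i ℕ.* μ i)

  n≤s₂ : n ℕ.≤ s₂
  n≤s₂ = sumℕ-mono-≤ (λ i → ℕ.m≤m*n (μ i) (μ i) {{ℕ.>-nonZero (1≤μ i)}})

  2≤n : 2 ℕ.≤ n
  2≤n = ℕ.≤-trans 2≤m (subst (ℕ._≤ n) (sumℕ-1 m) (sumℕ-mono-≤ 1≤μ))

  n≤n*n : n ℕ.≤ n ℕ.* n
  n≤n*n = ℕ.m≤m*n n n {{ℕ.>-nonZero (ℕ.≤-trans (ℕ.s≤s ℕ.z≤n) 2≤n)}}

  n≤n*n∸n : n ℕ.≤ n ℕ.* n ℕ.∸ n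
  n≤n*n∸n = ℕ.m+n≤o⇒m≤o∸n n (begin
    n ℕ.+ n             ≡⟨ cong (n ℕ.+_) (ℕ.+-identityʳ n) ⟨
    2 ℕ.* n             ≤⟨ ℕ.*-monoˡ-≤ n 2≤n ⟩
    n ℕ.* n             ∎)
    where open ℕ.≤-Reasoning

  Γ≡ : Γ ≡ fromℕ (k ℕ.* (s₂ ℕ.∸ n)) - fromℕ (n ℕ.* n ℕ.∸ n)
  Γ≡ = begin
    K * ν₂ - ν₁ * ν₁ - (K - 1ℚ) * ν₁
      ≡⟨ cong₂ (λ a b → K * a - b * b - (K - 1ℚ) * b) ν₂≡ (sym (fromℕ-sumℕ μ)) ⟩
    K * fromℕ s₂ - fromℕ n * fromℕ n - (K - 1ℚ) * fromℕ n
      ≡⟨ solve 3 (λ k s a → k :* s :- a :* a :- (k :- con 1ℚ) :* a := k :* (s :- a) :- (a :* a :- a)) refl K (fromℕ s₂) (fromℕ n) ⟩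
    K * (fromℕ s₂ - fromℕ n) - (fromℕ n * fromℕ n - fromℕ n)
      ≡⟨ cong₂ (λ a b → K * a - (b - fromℕ n)) (fromℕ-∸ n≤s₂) (fromℕ-* n n) ⟨
    K * fromℕ (s₂ ℕ.∸ n) - (fromℕ (n ℕ.* n) - fromℕ n)
      ≡⟨ cong₂ _-_ (fromℕ-* k (s₂ ℕ.∸ n)) (fromℕ-∸ n≤n*n) ⟨
    fromℕ (k ℕ.* (s₂ ℕ.∸ n)) - fromℕ (n ℕ.* n ℕ.∸ n)
      ∎
    where
    open ≡-Reasoning
    open WeightedMoments m k′ (fromℕ ∘ μ) using (ν₁; ν₂)
    K = fromℕ k
    ν₂≡ : ν₂ ≡ fromℕ s₂
    ν₂≡ = sym (trans (fromℕ-sumℕ (λ i → μ i ℕ.* μ i)) (∑-cong (allFin m) (λ i → fromℕ-* (μ i) (μ i))))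

  k<Υ⇒gap : (+ k / 1) <∞ Υ μ → suc (k ℕ.* (s₂ ℕ.∸ n)) ℕ.≤ n ℕ.* n ℕ.∸ n
  k<Υ⇒gap k<Υ with Υ-cases μ
  ... | inj₁ (s₂∸n≡0 , _) rewrite s₂∸n≡0 | ℕ.*-zeroʳ k = ℕ.≤-trans (ℕ.≤-trans (ℕ.s≤s ℕ.z≤n) 2≤n) n≤n*n∸n
  ... | inj₂ (d , s₂∸n≡1+d , Υ≡) rewrite s₂∸n≡1+d =
    subst (k ℕ.* suc d ℕ.<_) (ℕ.*-identityʳ (n ℕ.* n ℕ.∸ n)) (<-cross-multiply k 0 (n ℕ.* n ℕ.∸ n) d (subst ((+ k / 1) <∞_) Υ≡ k<Υ))

  Υ<k⇒gap : (+ k / 1) >∞ Υ μ → suc (n ℕ.* n ℕ.∸ n) ℕ.≤ k ℕ.* (s₂ ℕ.∸ n)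
  Υ<k⇒gap Υ<k with Υ-cases μ
  ... | inj₁ (_ , Υ≡∞) = ⊥-elim (subst ((+ k / 1) >∞_) Υ≡∞ Υ<k)
  ... | inj₂ (d , s₂∸n≡1+d , Υ≡) rewrite s₂∸n≡1+d =
    subst (ℕ._< k ℕ.* suc d) (ℕ.*-identityʳ (n ℕ.* n ℕ.∸ n)) (<-cross-multiply (n ℕ.* n ℕ.∸ n) d k 0 (subst ((+ k / 1) >∞_) Υ≡ Υ<k))

theorem1 : (m : ℕ) → m ℕ.≥ 2 → (μ : Fin m → ℕ) → (∀ i → μ i ℕ.≥ 1) →
    (k : ℕ) → m ℕ.≤ k →
    (((+ k / 1) <∞ Υ μ → IsLocalMax (β k μ) (U k)) ×
    ((+ k / 1) >∞ Υ μ → IsLocalMin (β k μ) (U k)))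
theorem1 m 2≤m μ 1≤μ k m≤k with ℕ.≤-trans 2≤m m≤k
... | ℕ.s≤s (ℕ.s≤s {n = k′} _) =
  (λ k<Υ → isLocalMax (subst (_≤ - 1ℚ) (sym Γ≡) (suc≤⇒fromℕ-fromℕ≤-1 (k<Υ⇒gap k<Υ)))) ,
  (λ Υ<k → isLocalMin (subst (1ℚ ≤_) (sym Γ≡) (suc≤⇒1≤fromℕ-fromℕ (Υ<k⇒gap Υ<k))))
  where
  open LocalExtremum m k′ μ
  open Threshold m k′ μ 2≤m 1≤μ
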